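{- Let $G$ be a finite connected graph with a harmonic action of $D_n=\langle\sigma_1,\sigma_2\rangle$ as described in the context, with vertices labeled $z_i^j$ ($1\le j\le s$) and $x_i^j,y_i^j$ ($1\le j\le t$), $i\in\{1,\dots,n\}$. A divisor $\delta$ of degree $0$ on $G$ can be written as $\delta=\delta_1+\delta_2$ with $\delta_1\in\mathcal{P}_1$ and $\delta_2\in\mathcal{P}_2$ if and only if all of the following hold: (1) $\sum_{i=1}^n i\,(X_i+Y_i+Z_i)\equiv 0 \pmod n$, where $X_i=\sum_{j=1}^t\delta(x_i^j)$, $Y_i=\sum_{j=1}^t\delta(y_i^j)$, $Z_i=\sum_{j=1}^s\delta(z_i^j)$; (2) for each $j=1,\dots,t$, $\sum_{i=1}^n\delta(x_i^j)=\sum_{i=1}^n\delta(y_i^j)$; (3) for each $j=1,\dots,s$, $\sum_{i=1}^n\delta(z_i^j)\equiv 0\pmod 2$.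
   Context: Graphs are finite, connected, may have multiple edges, no loops. A divisor on $G$ is a function from the vertex set to $\mathbb{Z}$; its degree is the sum of its values. Setting: $n\ge 2$, $D_n$ is the dihedral group of order $2n$ generated by involutions $\sigma_1,\sigma_2$, acting on $G$ by automorphisms harmonically (no non-identity element fixes both endpoints of an edge), and every $D_n$-orbit of vertices has $n$ or $2n$ points. The vertices are labeled so that there are $s$ orbits of size $n$, $\{z_i^j: i=1,\dots,n\}$ for $j=1,\dots,s$, and $t$ orbits of size $2n$, $\{x_i^j,y_i^j: i=1,\dots,n\}$ for $j=1,\dots,t$, with (subscripts mod $n$) $\sigma_1(z_i^j)=z_{n+1-i}^j$, $\sigma_1(x_i^j)=y_{n+1-i}^j$, $\sigma_1(y_i^j)=x_{n+1-i}^j$, $\sigma_2(z_i^j)=z_{n+2-i}^j$, $\sigma_2(x_i^j)=y_{n+2-i}^j$, $\sigma_2(y_i^j)=x_{n+2-i}^j$. For a subgroup $\Gamma$ the quotient graph $G/\Gamma$ has vertices the $\Gamma$-orbits of vertices and edges the $\Gamma$-orbits of edges, with quotient map $\phi$; the pullback of a divisor $\hat D$ on $G/\Gamma$ is $\phi^*(\hat D)(v)=|\mathrm{Stab}_\Gamma(v)|\,\hat D(\phi(v))$. Let $H_1=G/\langle\sigma_1\rangle$, $H_2=G/\langle\sigma_2\rangle$, $H_3=G/\langle\sigma_1\sigma_2\rangle$, and let $\mathcal{P}_k$ be the set of divisors on $G$ of the form $\phi_k^*(\hat D)$ with $\hat D$ a degree-zero divisor on $H_k$. -}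

module Defs where

open import Data.Nat as ℕ using (ℕ; zero; suc; _∸_; _≤ᵇ_; _≡ᵇ_; NonZero)
open import Data.Nat.DivMod using (_mod_)
open import Data.Fin using (Fin; toℕ)
open import Data.Bool using (Bool; true; false; if_then_else_)
open import Data.Integer as ℤ using (ℤ; +_; 0ℤ)
open import Data.List using (List; map; foldr; allFin; cartesianProduct; _++_)
open import Data.Product using (Σ; _×_; _,_; ∃; proj₁; proj₂)
open import Function using (_∘_; id)
open import Relation.Binary.PropositionalEquality using (_≡_)
open import Relation.Nullary using (¬_)

-- Index i : Fin n stands for the paper's subscript (toℕ i + 1) ∈ {1,…,n}.
-- z j i = z_{i+1}^{j+1} (j < s),  x j i = x_{i+1}^{j+1}, y j i = y_{i+1}^{j+1} (j < t).

data V (n s t : ℕ) : Set where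
  z : Fin s → Fin n → V n s t
  x : Fin t → Fin n → V n s t
  y : Fin t → Fin n → V n s t

-- index maps (0-based):  paper's i ↦ n+1-i  becomes a ↦ n-1-a ;
--                        paper's i ↦ n+2-i (mod n) becomes a ↦ (n-a) mod n
r₁ : (n : ℕ) .{{_ : NonZero n}} → Fin n → Fin n
r₁ n a = ((n ℕ.+ n ∸ 1) ∸ toℕ a) mod n

r₂ : (n : ℕ) .{{_ : NonZero n}} → Fin n → Fin n
r₂ n a = ((n ℕ.+ n) ∸ toℕ a) mod n

σ₁ : ∀ {n s t} .{{_ : NonZero n}} → V n s t → V n s t
σ₁ {n} (z j i) = z j (r₁ n i)
σ₁ {n} (x j i) = y j (r₁ n i)
σ₁ {n} (y j i) = x j (r₁ n i)

σ₂ : ∀ {n s t} .{{_ : NonZero n}} → V n s t → V n s t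
σ₂ {n} (z j i) = z j (r₂ n i)
σ₂ {n} (x j i) = y j (r₂ n i)
σ₂ {n} (y j i) = x j (r₂ n i)

-- ρ = σ₁σ₂ ; the elements of D_n are exactly ρ^k σ₁^b, k < n, b ∈ Bool
ρ : ∀ {n s t} .{{_ : NonZero n}} → V n s t → V n s t
ρ = σ₁ ∘ σ₂

iter : ∀ {A : Set} → ℕ → (A → A) → A → A
iter zero    f = id
iter (suc k) f = f ∘ iter k f

act : ∀ {n s t} .{{_ : NonZero n}} → Fin n → Bool → V n s t → V n s t
act k false = iter (toℕ k) ρ
act k true  = iter (toℕ k) ρ ∘ σ₁

IsIdentityElt : ∀ {n} → Fin n → Bool → Set
IsIdentityElt k b = (toℕ k ≡ 0) × (b ≡ false)

-- A finite multigraph on V: mult u v = number of edges between u and v.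

record HarmonicDnGraph (n s t : ℕ) .{{_ : NonZero n}} : Set where
  field
    mult      : V n s t → V n s t → ℕ
    symm      : ∀ u v → mult u v ≡ mult v u
    noLoops   : ∀ v → mult v v ≡ 0
    auto₁     : ∀ u v → mult (σ₁ u) (σ₁ v) ≡ mult u v
    auto₂     : ∀ u v → mult (σ₂ u) (σ₂ v) ≡ mult u v
    harmonic  : ∀ u v → 0 ℕ.< mult u v → ∀ k b → ¬ IsIdentityElt k b →
                ¬ ((act k b u ≡ u) × (act k b v ≡ v))

data Reach {n s t : ℕ} .{{_ : NonZero n}} (G : HarmonicDnGraph n s t) :
           V n s t → V n s t → Set where
  here : ∀ {v} → Reach G v v
  step : ∀ {u v w} → 0 ℕ.< HarmonicDnGraph.mult G u v → Reach G v w → Reach G u w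

Connected : ∀ {n s t} .{{_ : NonZero n}} → HarmonicDnGraph n s t → Set
Connected G = ∀ u v → Reach G u v

allV : (n s t : ℕ) → List (V n s t)
allV n s t =
     map (λ p → z (proj₁ p) (proj₂ p)) (cartesianProduct (allFin s) (allFin n))
  ++ map (λ p → x (proj₁ p) (proj₂ p)) (cartesianProduct (allFin t) (allFin n))
  ++ map (λ p → y (proj₁ p) (proj₂ p)) (cartesianProduct (allFin t) (allFin n))

sumℤ : List ℤ → ℤ
sumℤ = foldr ℤ._+_ 0ℤ

Divisor : (n s t : ℕ) → Set
Divisor n s t = V n s t → ℤ

deg : ∀ {n s t} → Divisor n s t → ℤ
deg {n} {s} {t} D = sumℤ (map D (allV n s t))

-- injective ranking of vertices, used to pick the orbit representative
rank : ∀ {n s t} → V n s t → ℕ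
rank {n} (z j i) = 3 ℕ.* (toℕ j ℕ.* n ℕ.+ toℕ i)
rank {n} (x j i) = 3 ℕ.* (toℕ j ℕ.* n ℕ.+ toℕ i) ℕ.+ 1
rank {n} (y j i) = 3 ℕ.* (toℕ j ℕ.* n ℕ.+ toℕ i) ℕ.+ 2

-- Quotient by Γ = ⟨τ⟩ with τ an involution (τ = σ₁ or σ₂).
-- A divisor on G/Γ is represented as a Γ-invariant function on V
-- (= a function on Γ-orbits).  Its degree is the sum over orbits,
-- each orbit {v, τ v} counted once via its minimal-rank representative.

InvariantUnder : ∀ {n s t} → (V n s t → V n s t) → Divisor n s t → Set
InvariantUnder τ D = ∀ v → D (τ v) ≡ D v

degQuot : ∀ {n s t} → (V n s t → V n s t) → Divisor n s t → ℤ
degQuot {n} {s} {t} τ D =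
  sumℤ (map (λ v → if rank v ≤ᵇ rank (τ v) then D v else 0ℤ) (allV n s t))

-- |Stab_Γ(v)| for Γ = ⟨τ⟩ of order 2
stab : ∀ {n s t} → (V n s t → V n s t) → V n s t → ℤ
stab τ v = if rank (τ v) ≡ᵇ rank v then + 2 else + 1

-- δ ∈ P_τ : δ = φ*(D̂) with D̂ a degree-zero divisor on G/⟨τ⟩
InPullback : ∀ {n s t} → (V n s t → V n s t) → Divisor n s t → Set
InPullback τ δ =
  Σ (Divisor _ _ _) λ D̂ → InvariantUnder τ D̂ × (degQuot τ D̂ ≡ 0ℤ)
                         × (∀ v → δ v ≡ stab τ v ℤ.* D̂ v)

P₁ P₂ : ∀ {n s t} .{{_ : NonZero n}} → Divisor n s t → Set
P₁ = InPullback σ₁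
P₂ = InPullback σ₂

sumFin : (m : ℕ) → (Fin m → ℤ) → ℤ
sumFin m f = sumℤ (map f (allFin m))

Xs Ys Zs : ∀ {n s t} → Divisor n s t → Fin n → ℤ
Xs {n} {s} {t} δ i = sumFin t (λ j → δ (x j i))
Ys {n} {s} {t} δ i = sumFin t (λ j → δ (y j i))
Zs {n} {s} {t} δ i = sumFin s (λ j → δ (z j i))

-- Σ_{i=1}^n i (X_i + Y_i + Z_i), with paper subscript i = toℕ a + 1
weightedSum : ∀ {n s t} → Divisor n s t → ℤ
weightedSum {n} δ = sumFin n (λ a → + (suc (toℕ a)) ℤ.* (Xs δ a ℤ.+ Ys δ a ℤ.+ Zs δ a))

-- Write δ₁ = φ₁*D₁ and δ₂ = φ₂*D₂ with Dₖ a σₖ-invariant divisor.  On an x/y-orbit, φₖ*D takes the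
-- values D(x_i) and D(x_{rₖ i}) at x_i and y_i, where rₖ is the reflection of the indices induced by σₖ; on
-- a z-orbit it multiplies D by |Stab| ∈ {1, 2}.  Hence δ₁ + δ₂ has equal x- and y-sums on every orbit and
-- an even sum on every z-orbit, deg φₖ*D = 2 deg D, and since i + rₖ(i) is constant modulo n (n + 1 for σ₁,
-- 2 for σ₂) the weighted sum of φ₁*D₁ + φ₂*D₂ is deg D₁ + 2 deg D₂ modulo n.
-- Conversely, conditions (2) and (3) let one split every orbit by prefix sums along the rotation σ₁σ₂,
-- giving δ = φ₁*D₁ + φ₂*D₂ with D₁, D₂ of some degrees q₁, q₂.  Then deg δ = 0 forces q₁ + q₂ = 0,
-- condition (1) forces n ∣ q₁, and subtracting q₁/n times a divisor that is a pullback from both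
-- quotients makes both degrees vanish.

module Submission where

open import Data.Bool using (Bool; true; false; if_then_else_; T)
open import Data.Empty using (⊥-elim)
open import Data.Fin as Fin using (Fin; toℕ)
import Data.Fin.Properties as FinP
open import Data.Fin.Permutation using (permutation)
open import Data.Integer as ℤ using (ℤ; +_; 0ℤ; _+_; _*_; -_; _-_)
open import Data.Integer.Divisibility using (_∣_)
import Data.Integer.Divisibility.Signed as Signed
import Data.Integer.Properties as ℤP
open import Algebra.Properties.CommutativeSemigroup ℤP.+-commutativeSemigroup
  using () renaming (interchange to +-interchange)
open import Algebra.Properties.Semiring.Sum ℤP.+-*-semiring
  using (sum; sum-syntax; sum-cong-≗; sum-replicate-zero; ∑-distrib-+; ∑-comm; sum-permute; *-distribˡ-sum)
open import Data.Integer.Tactic.RingSolver using (solve-∀)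
open import Data.List using (List; []; _∷_; map; _++_; allFin; tabulate; cartesianProduct)
import Data.List.Properties as ListP
open import Data.Nat as ℕ using (ℕ; zero; suc; NonZero; _≤_; _≤ᵇ_; _<ᵇ_; _≡ᵇ_; _∸_)
open import Data.Nat.DivMod using (_%_; [m+n]%n≡m%n; m<n⇒m%n≡m; n%n≡0)
import Data.Nat.Properties as ℕP
open import Data.Product using (Σ; _×_; _,_; proj₁; proj₂)
open import Function using (_∘_; id)
open import Function.Bundles using (_⇔_; mk⇔)
open import Relation.Binary.Definitions using (tri<; tri≈; tri>)
open import Relation.Binary.PropositionalEquality

open import Defs

sumℤ-++ : ∀ xs ys → sumℤ (xs ++ ys) ≡ sumℤ xs + sumℤ ys
sumℤ-++ []       ys = sym (ℤP.+-identityˡ _)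
sumℤ-++ (v ∷ xs) ys = trans (cong (_+_ v) (sumℤ-++ xs ys)) (sym (ℤP.+-assoc v _ _))

sumℤ-map-+ : ∀ {A : Set} {f g h : A → ℤ} → (∀ a → f a ≡ g a + h a) →
             ∀ xs → sumℤ (map f xs) ≡ sumℤ (map g xs) + sumℤ (map h xs)
sumℤ-map-+ f≡g+h []       = refl
sumℤ-map-+ {g = g} {h} f≡g+h (a ∷ xs) =
  trans (cong₂ _+_ (f≡g+h a) (sumℤ-map-+ f≡g+h xs)) (+-interchange (g a) (h a) _ _)

sumℤ-map-* : ∀ {A : Set} (k : ℤ) (f : A → ℤ) xs → sumℤ (map (λ a → k * f a) xs) ≡ k * sumℤ (map f xs)
sumℤ-map-* k f []       = sym (ℤP.*-zeroʳ k)
sumℤ-map-* k f (a ∷ xs) = trans (cong (_+_ (k * f a)) (sumℤ-map-* k f xs)) (sym (ℤP.*-distribˡ-+ k (f a) _))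

sumℤ-tabulate : ∀ {n} (f : Fin n → ℤ) → sumℤ (tabulate f) ≡ sum f
sumℤ-tabulate {zero}  f = refl
sumℤ-tabulate {suc n} f = cong (_+_ (f Fin.zero)) (sumℤ-tabulate (f ∘ Fin.suc))

sumFin≡sum : ∀ n (f : Fin n → ℤ) → sumFin n f ≡ sum f
sumFin≡sum n f = trans (cong sumℤ (ListP.map-tabulate id f)) (sumℤ-tabulate f)

∑∑ : ∀ {a b} → (Fin a → Fin b → ℤ) → ℤ
∑∑ f = sum (λ j → sum (f j))

∑∑-cong : ∀ {a b} {f g : Fin a → Fin b → ℤ} → (∀ j i → f j i ≡ g j i) → ∑∑ f ≡ ∑∑ g
∑∑-cong f≡g = sum-cong-≗ (λ j → sum-cong-≗ (f≡g j))

∑∑-+ : ∀ {a b} (f g : Fin a → Fin b → ℤ) → ∑∑ (λ j i → f j i + g j i) ≡ ∑∑ f + ∑∑ g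
∑∑-+ f g = trans (sum-cong-≗ (λ j → ∑-distrib-+ (f j) (g j))) (∑-distrib-+ (sum ∘ f) (sum ∘ g))

∑∑-* : ∀ {a b} (k : ℤ) (f : Fin a → Fin b → ℤ) → ∑∑ (λ j i → k * f j i) ≡ k * ∑∑ f
∑∑-* k f = sym (trans (*-distribˡ-sum k (sum ∘ f)) (sum-cong-≗ (λ j → *-distribˡ-sum k (f j))))

sumℤ-cartesianProduct : ∀ {A : Set} {b} (f : A → Fin b → ℤ) xs →
  sumℤ (map (λ p → f (proj₁ p) (proj₂ p)) (cartesianProduct xs (allFin b))) ≡ sumℤ (map (sum ∘ f) xs)
sumℤ-cartesianProduct {b = b} f [] = refl
sumℤ-cartesianProduct {b = b} f (a ∷ xs) = begin
  sumℤ (map g (map (a ,_) (allFin b) ++ cartesianProduct xs (allFin b)))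
    ≡⟨ cong sumℤ (ListP.map-++ g (map (a ,_) (allFin b)) _) ⟩
  sumℤ (map g (map (a ,_) (allFin b)) ++ map g (cartesianProduct xs (allFin b)))
    ≡⟨ sumℤ-++ (map g (map (a ,_) (allFin b))) _ ⟩
  sumℤ (map g (map (a ,_) (allFin b))) + sumℤ (map g (cartesianProduct xs (allFin b)))
    ≡⟨ cong₂ _+_ (trans (cong sumℤ (sym (ListP.map-∘ (allFin b)))) (sumFin≡sum b (f a)))
                 (sumℤ-cartesianProduct f xs) ⟩
  sum (f a) + sumℤ (map (sum ∘ f) xs) ∎
  where
  open ≡-Reasoning
  g = λ p → f (proj₁ p) (proj₂ p)

sumℤ-allV : ∀ {n s t} (g : V n s t → ℤ) →
  sumℤ (map g (allV n s t)) ≡ ∑∑ (λ j i → g (z j i)) + (∑∑ (λ j i → g (x j i)) + ∑∑ (λ j i → g (y j i)))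
sumℤ-allV {n} {s} {t} g = begin
  sumℤ (map g (zOrbits ++ xOrbits ++ yOrbits))
    ≡⟨ cong sumℤ (trans (ListP.map-++ g zOrbits _) (cong (map g zOrbits ++_) (ListP.map-++ g xOrbits yOrbits))) ⟩
  sumℤ (map g zOrbits ++ map g xOrbits ++ map g yOrbits)
    ≡⟨ trans (sumℤ-++ (map g zOrbits) _) (cong (_+_ (sumℤ (map g zOrbits))) (sumℤ-++ (map g xOrbits) _)) ⟩
  sumℤ (map g zOrbits) + (sumℤ (map g xOrbits) + sumℤ (map g yOrbits))
    ≡⟨ cong₂ _+_ (orbitSum z) (cong₂ _+_ (orbitSum x) (orbitSum y)) ⟩
  ∑∑ (λ j i → g (z j i)) + (∑∑ (λ j i → g (x j i)) + ∑∑ (λ j i → g (y j i))) ∎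
  where
  open ≡-Reasoning
  orbits : ∀ {m} → (Fin m → Fin n → V n s t) → List (V n s t)
  orbits c = map (λ p → c (proj₁ p) (proj₂ p)) (cartesianProduct (allFin _) (allFin n))
  zOrbits = orbits z
  xOrbits = orbits x
  yOrbits = orbits y
  orbitSum : ∀ {m} (c : Fin m → Fin n → V n s t) → sumℤ (map g (orbits c)) ≡ ∑∑ (λ j i → g (c j i))
  orbitSum {m} c = begin
    sumℤ (map g (orbits c))
      ≡⟨ cong sumℤ (sym (ListP.map-∘ (cartesianProduct (allFin m) (allFin n)))) ⟩
    sumℤ (map (λ p → g (c (proj₁ p) (proj₂ p))) (cartesianProduct (allFin m) (allFin n)))
      ≡⟨ sumℤ-cartesianProduct (λ j i → g (c j i)) (allFin m) ⟩
    sumFin m (λ j → sum (λ i → g (c j i)))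
      ≡⟨ sumFin≡sum m _ ⟩
    ∑∑ (λ j i → g (c j i)) ∎

when : Bool → ℤ → ℤ
when b v = if b then v else 0ℤ

when-+ : ∀ b u v → when b (u + v) ≡ when b u + when b v
when-+ true  u v = refl
when-+ false u v = refl

when-* : ∀ b k v → when b (k * v) ≡ k * when b v
when-* true  k v = refl
when-* false k v = sym (ℤP.*-zeroʳ k)

≤ᵇ-suc : ∀ a c → (suc a ≤ᵇ suc c) ≡ (a ≤ᵇ c)
≤ᵇ-suc zero    c = refl
≤ᵇ-suc (suc a) c = refl

≡ᵇ-sym : ∀ a c → (a ≡ᵇ c) ≡ (c ≡ᵇ a)
≡ᵇ-sym zero    zero    = refl
≡ᵇ-sym zero    (suc c) = refl
≡ᵇ-sym (suc a) zero    = refl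
≡ᵇ-sym (suc a) (suc c) = ≡ᵇ-sym a c

when-≤ᵇ+when-<ᵇ : ∀ a c v → when (a ≤ᵇ c) v + when (c <ᵇ a) v ≡ v
when-≤ᵇ+when-<ᵇ zero    zero    v = ℤP.+-identityʳ v
when-≤ᵇ+when-<ᵇ zero    (suc c) v = ℤP.+-identityʳ v
when-≤ᵇ+when-<ᵇ (suc a) zero    v = ℤP.+-identityˡ v
when-≤ᵇ+when-<ᵇ (suc a) (suc c) v =
  trans (cong (λ b → when b v + when (c <ᵇ a) v) (≤ᵇ-suc a c)) (when-≤ᵇ+when-<ᵇ a c v)

2*-double : ∀ v → + 2 * v ≡ v + v
2*-double v = trans (ℤP.*-distribʳ-+ v (+ 1) (+ 1)) (cong₂ _+_ (ℤP.*-identityˡ v) (ℤP.*-identityˡ v))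

-- At a fixed point (a = c) both guards hold, which accounts for the factor 2.
stabFactor-split : ∀ a c v → (if c ≡ᵇ a then + 2 else + 1) * v ≡ when (a ≤ᵇ c) v + when (c ≤ᵇ a) v
stabFactor-split zero    zero    v = 2*-double v
stabFactor-split zero    (suc c) v = trans (ℤP.*-identityˡ v) (sym (ℤP.+-identityʳ v))
stabFactor-split (suc a) zero    v = trans (ℤP.*-identityˡ v) (sym (ℤP.+-identityˡ v))
stabFactor-split (suc a) (suc c) v =
  trans (stabFactor-split a c v) (sym (cong₂ (λ b b′ → when b v + when b′ v) (≤ᵇ-suc a c) (≤ᵇ-suc c a)))

-- Involutions of Fin n

module Involution {n : ℕ} (r : Fin n → Fin n) (r-involutive : ∀ i → r (r i) ≡ i) where

  IsRep IsFixed : Fin n → Bool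
  IsRep   i = toℕ i ≤ᵇ toℕ (r i)
  IsFixed i = toℕ (r i) ≡ᵇ toℕ i

  stabFactor : Fin n → ℤ
  stabFactor i = if IsFixed i then + 2 else + 1

  fixed : ∀ {i} → T (IsFixed i) → r i ≡ i
  fixed p = FinP.toℕ-injective (ℕP.≡ᵇ⇒≡ _ _ p)

  IsFixed-∘r : ∀ i → IsFixed (r i) ≡ IsFixed i
  IsFixed-∘r i = trans (cong (λ k → toℕ k ≡ᵇ toℕ (r i)) (r-involutive i)) (≡ᵇ-sym (toℕ i) (toℕ (r i)))

  sum-∘r : ∀ f → sum f ≡ sum (f ∘ r)
  sum-∘r f = sum-permute f (permutation r r r-involutive r-involutive)

  ∑-stabFactor : ∀ (w b : Fin n → ℤ) → (∀ i → b (r i) ≡ b i) →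
    ∑[ i < n ] (w i * (stabFactor i * b i)) ≡ ∑[ i < n ] ((w i + w (r i)) * when (IsRep i) (b i))
  ∑-stabFactor w b b∘r = begin
    ∑[ i < n ] (w i * (stabFactor i * b i))
      ≡⟨ sum-cong-≗ (λ i → trans (cong (w i *_) (stabFactor-split (toℕ i) (toℕ (r i)) (b i)))
                                 (ℤP.*-distribˡ-+ (w i) _ _)) ⟩
    ∑[ i < n ] (w i * rep i + w i * when (toℕ (r i) ≤ᵇ toℕ i) (b i))
      ≡⟨ ∑-distrib-+ (λ i → w i * rep i) (λ i → w i * when (toℕ (r i) ≤ᵇ toℕ i) (b i)) ⟩
    ∑[ i < n ] (w i * rep i) + ∑[ i < n ] (w i * when (toℕ (r i) ≤ᵇ toℕ i) (b i))
      ≡⟨ cong (_+_ (∑[ i < n ] (w i * rep i))) (trans (sum-∘r (λ i → w i * when (toℕ (r i) ≤ᵇ toℕ i) (b i))) (sum-cong-≗ reflected)) ⟩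
    ∑[ i < n ] (w i * rep i) + ∑[ i < n ] (w (r i) * rep i)
      ≡⟨ sym (∑-distrib-+ (λ i → w i * rep i) (λ i → w (r i) * rep i)) ⟩
    ∑[ i < n ] (w i * rep i + w (r i) * rep i)
      ≡⟨ sum-cong-≗ (λ i → sym (ℤP.*-distribʳ-+ (rep i) (w i) (w (r i)))) ⟩
    ∑[ i < n ] ((w i + w (r i)) * rep i) ∎
    where
    open ≡-Reasoning
    rep : Fin n → ℤ
    rep i = when (IsRep i) (b i)
    reflected : ∀ i → w (r i) * when (toℕ (r (r i)) ≤ᵇ toℕ (r i)) (b (r i)) ≡ w (r i) * rep i
    reflected i = cong₂ (λ k v → w (r i) * when (toℕ k ≤ᵇ toℕ (r i)) v) (r-involutive i) (b∘r i)

  ∑-orbits : ∀ (a : Fin n → ℤ) →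
    ∑[ i < n ] when (IsRep i) (a i) + ∑[ i < n ] when (toℕ i <ᵇ toℕ (r i)) (a (r i)) ≡ sum a
  ∑-orbits a = begin
    ∑[ i < n ] when (IsRep i) (a i) + ∑[ i < n ] when (toℕ i <ᵇ toℕ (r i)) (a (r i))
      ≡⟨ cong (_+_ (∑[ i < n ] when (IsRep i) (a i))) (trans (sum-∘r (λ i → when (toℕ i <ᵇ toℕ (r i)) (a (r i)))) (sum-cong-≗ (λ i →
           cong (λ k → when (toℕ (r i) <ᵇ toℕ k) (a k)) (r-involutive i)))) ⟩
    ∑[ i < n ] when (IsRep i) (a i) + ∑[ i < n ] when (toℕ (r i) <ᵇ toℕ i) (a i)
      ≡⟨ sym (∑-distrib-+ (λ i → when (IsRep i) (a i)) (λ i → when (toℕ (r i) <ᵇ toℕ i) (a i))) ⟩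
    ∑[ i < n ] (when (IsRep i) (a i) + when (toℕ (r i) <ᵇ toℕ i) (a i))
      ≡⟨ sum-cong-≗ (λ i → when-≤ᵇ+when-<ᵇ (toℕ i) (toℕ (r i)) (a i)) ⟩
    sum a ∎
    where open ≡-Reasoning

  halvedAtFixed : (half full : Fin n → ℤ) → Fin n → ℤ
  halvedAtFixed half full i = if IsFixed i then half i else full i

  halvedAtFixed-∘r : ∀ half full → (∀ i → full (r i) ≡ full i) →
                     ∀ i → halvedAtFixed half full (r i) ≡ halvedAtFixed half full i
  halvedAtFixed-∘r half full full∘r i with IsFixed i in eq
  ... | true  = trans (cong (halvedAtFixed half full) (fixed (subst T (sym eq) _)))
                      (cong (λ b → if b then half i else full i) eq)
  ... | false = trans (cong (λ b → if b then half (r i) else full (r i)) (trans (IsFixed-∘r i) eq))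
                      (full∘r i)

  stabFactor-halvedAtFixed : ∀ half full i → (T (IsFixed i) → + 2 * half i ≡ full i) →
                             stabFactor i * halvedAtFixed half full i ≡ full i
  stabFactor-halvedAtFixed half full i halves with IsFixed i
  ... | true  = halves _
  ... | false = ℤP.*-identityˡ (full i)

-- The index reflections r₁ and r₂

module _ {n' : ℕ} where

  private
    reduce : ∀ a → a ℕ.≤ n' → ((n' ℕ.+ suc n') ∸ a) % suc n' ≡ n' ∸ a
    reduce a a≤n' = begin
      ((n' ℕ.+ suc n') ∸ a) % suc n' ≡⟨ cong (_% suc n') (ℕP.+-∸-comm (suc n') a≤n') ⟩
      ((n' ∸ a) ℕ.+ suc n') % suc n' ≡⟨ [m+n]%n≡m%n (n' ∸ a) (suc n') ⟩
      (n' ∸ a) % suc n'              ≡⟨ m<n⇒m%n≡m (ℕ.s≤s (ℕP.m∸n≤m n' a)) ⟩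
      n' ∸ a                         ∎
      where open ≡-Reasoning

  toℕ-r₁ : ∀ (i : Fin (suc n')) → toℕ (r₁ (suc n') i) ≡ n' ∸ toℕ i
  toℕ-r₁ i = trans (FinP.toℕ-fromℕ< _) (reduce (toℕ i) (FinP.toℕ≤pred[n] i))

  toℕ-r₂ : ∀ (i : Fin (suc n')) → 0 ℕ.< toℕ i → toℕ (r₂ (suc n') i) ≡ suc n' ∸ toℕ i
  toℕ-r₂ (Fin.suc k) _ = trans (FinP.toℕ-fromℕ< _) (reduce (toℕ k) (FinP.toℕ≤n k))

  r₂-zero : r₂ (suc n') Fin.zero ≡ Fin.zero
  r₂-zero = FinP.toℕ-injective (trans (FinP.toℕ-fromℕ< _)
                                       (trans ([m+n]%n≡m%n (suc n') (suc n')) (n%n≡0 (suc n'))))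

  suc-toℕ-r₁ : ∀ (i : Fin (suc n')) → suc (toℕ (r₁ (suc n') i)) ≡ suc n' ∸ toℕ i
  suc-toℕ-r₁ i = trans (cong suc (toℕ-r₁ i)) (sym (ℕP.+-∸-assoc 1 (FinP.toℕ≤pred[n] i)))

  ∸-toℕ-r₁ : ∀ (i : Fin (suc n')) → suc n' ∸ toℕ (r₁ (suc n') i) ≡ suc (toℕ i)
  ∸-toℕ-r₁ i = begin
    suc n' ∸ toℕ (r₁ (suc n') i) ≡⟨ cong (suc n' ∸_) (toℕ-r₁ i) ⟩
    suc n' ∸ (n' ∸ toℕ i)        ≡⟨ ℕP.+-∸-assoc 1 (ℕP.m∸n≤m n' (toℕ i)) ⟩
    suc (n' ∸ (n' ∸ toℕ i))      ≡⟨ cong suc (ℕP.m∸[m∸n]≡n (FinP.toℕ≤pred[n] i)) ⟩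
    suc (toℕ i)                  ∎
    where open ≡-Reasoning

  ∸-toℕ-r₂ : ∀ (i : Fin (suc n')) → 0 ℕ.< toℕ i → suc n' ∸ toℕ (r₂ (suc n') i) ≡ toℕ i
  ∸-toℕ-r₂ i 0<i = trans (cong (suc n' ∸_) (toℕ-r₂ i 0<i)) (ℕP.m∸[m∸n]≡n (FinP.toℕ≤n i))

  r₁-involutive : ∀ (i : Fin (suc n')) → r₁ (suc n') (r₁ (suc n') i) ≡ i
  r₁-involutive i = FinP.toℕ-injective (begin
    toℕ (r₁ (suc n') (r₁ (suc n') i)) ≡⟨ toℕ-r₁ (r₁ (suc n') i) ⟩
    n' ∸ toℕ (r₁ (suc n') i)          ≡⟨ cong (n' ∸_) (toℕ-r₁ i) ⟩
    n' ∸ (n' ∸ toℕ i)                 ≡⟨ ℕP.m∸[m∸n]≡n (FinP.toℕ≤pred[n] i) ⟩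
    toℕ i                             ∎)
    where open ≡-Reasoning

  r₂-involutive : ∀ (i : Fin (suc n')) → r₂ (suc n') (r₂ (suc n') i) ≡ i
  r₂-involutive Fin.zero    = trans (cong (r₂ (suc n')) r₂-zero) r₂-zero
  r₂-involutive i@(Fin.suc k) = FinP.toℕ-injective (begin
    toℕ (r₂ (suc n') (r₂ (suc n') i)) ≡⟨ toℕ-r₂ (r₂ (suc n') i) 0<r₂i ⟩
    suc n' ∸ toℕ (r₂ (suc n') i)      ≡⟨ ∸-toℕ-r₂ i ℕ.z<s ⟩
    toℕ i                             ∎)
    where
    open ≡-Reasoning
    0<r₂i : 0 ℕ.< toℕ (r₂ (suc n') i)
    0<r₂i = subst (0 ℕ.<_) (sym (toℕ-r₂ i ℕ.z<s)) (ℕP.m<n⇒0<n∸m (FinP.toℕ<n i))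

  toℕ-r₁∘r₂-suc : ∀ (k : Fin n') → toℕ (r₁ (suc n') (r₂ (suc n') (Fin.suc k))) ≡ toℕ k
  toℕ-r₁∘r₂-suc k = begin
    toℕ (r₁ (suc n') (r₂ (suc n') (Fin.suc k))) ≡⟨ toℕ-r₁ (r₂ (suc n') (Fin.suc k)) ⟩
    n' ∸ toℕ (r₂ (suc n') (Fin.suc k))          ≡⟨ cong (n' ∸_) (toℕ-r₂ (Fin.suc k) ℕ.z<s) ⟩
    n' ∸ (n' ∸ toℕ k)                           ≡⟨ ℕP.m∸[m∸n]≡n (FinP.toℕ≤n k) ⟩
    toℕ k                                       ∎
    where open ≡-Reasoning

T-ext : ∀ {b c : Bool} → (T b → T c) → (T c → T b) → b ≡ c
T-ext {false} {false} _ _ = refl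
T-ext {false} {true}  _ g = ⊥-elim (g _)
T-ext {true}  {false} f _ = ⊥-elim (f _)
T-ext {true}  {true}  _ _ = refl

+-≤ᵇ-cancelˡ : ∀ A a b → (A ℕ.+ a ≤ᵇ A ℕ.+ b) ≡ (a ≤ᵇ b)
+-≤ᵇ-cancelˡ zero    a b = refl
+-≤ᵇ-cancelˡ (suc A) a b = trans (≤ᵇ-suc (A ℕ.+ a) (A ℕ.+ b)) (+-≤ᵇ-cancelˡ A a b)

+-<ᵇ-cancelˡ : ∀ A a b → (A ℕ.+ a <ᵇ A ℕ.+ b) ≡ (a <ᵇ b)
+-<ᵇ-cancelˡ zero    a b = refl
+-<ᵇ-cancelˡ (suc A) a b = +-<ᵇ-cancelˡ A a b

+-≡ᵇ-cancelˡ : ∀ A a b → (A ℕ.+ a ≡ᵇ A ℕ.+ b) ≡ (a ≡ᵇ b)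
+-≡ᵇ-cancelˡ zero    a b = refl
+-≡ᵇ-cancelˡ (suc A) a b = +-≡ᵇ-cancelˡ A a b

-- Vertex ranks have the form 3 * position + tag with tag < 3, so they compare lexicographically.
lex-< : ∀ {X Y u v} → X ℕ.< Y → u ℕ.< 3 → 3 ℕ.* X ℕ.+ u ℕ.< 3 ℕ.* Y ℕ.+ v
lex-< {X} {Y} {u} {v} X<Y u<3 = begin-strict
  3 ℕ.* X ℕ.+ u   <⟨ ℕP.+-monoʳ-< (3 ℕ.* X) u<3 ⟩
  3 ℕ.* X ℕ.+ 3   ≡⟨ trans (ℕP.+-comm (3 ℕ.* X) 3) (sym (ℕP.*-suc 3 X)) ⟩
  3 ℕ.* suc X     ≤⟨ ℕP.*-monoʳ-≤ 3 X<Y ⟩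
  3 ℕ.* Y         ≤⟨ ℕP.m≤m+n (3 ℕ.* Y) v ⟩
  3 ℕ.* Y ℕ.+ v   ∎
  where open ℕP.≤-Reasoning

lex-≤ᵇ-aligned : ∀ {u v} X Y → u ℕ.≤ v → v ℕ.< 3 → (3 ℕ.* X ℕ.+ u ≤ᵇ 3 ℕ.* Y ℕ.+ v) ≡ (X ≤ᵇ Y)
lex-≤ᵇ-aligned {u} {v} X Y u≤v v<3 = T-ext
  (λ p → ℕP.≤⇒≤ᵇ {X} {Y} (ℕP.≮⇒≥ (λ Y<X → ℕP.<⇒≱ (lex-< Y<X v<3) (ℕP.≤ᵇ⇒≤ _ _ p))))
  (λ p → ℕP.≤⇒≤ᵇ {3 ℕ.* X ℕ.+ u} {3 ℕ.* Y ℕ.+ v}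
           (ℕP.+-mono-≤ (ℕP.*-monoʳ-≤ 3 (ℕP.≤ᵇ⇒≤ X Y p)) u≤v))

lex-≤ᵇ-crossed : ∀ {u v} X Y → v ℕ.< u → u ℕ.< 3 → (3 ℕ.* X ℕ.+ u ≤ᵇ 3 ℕ.* Y ℕ.+ v) ≡ (X <ᵇ Y)
lex-≤ᵇ-crossed {u} {v} X Y v<u u<3 = T-ext
  (λ p → ℕP.<⇒<ᵇ {X} {Y} (ℕP.≰⇒> (λ Y≤X →
           ℕP.<⇒≱ (ℕP.+-mono-≤-< (ℕP.*-monoʳ-≤ 3 Y≤X) v<u) (ℕP.≤ᵇ⇒≤ _ _ p))))
  (λ p → ℕP.≤⇒≤ᵇ {3 ℕ.* X ℕ.+ u} {3 ℕ.* Y ℕ.+ v} (ℕP.<⇒≤ (lex-< (ℕP.<ᵇ⇒< X Y p) u<3)))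

lex-≡ᵇ-aligned : ∀ X Y u → (3 ℕ.* X ℕ.+ u ≡ᵇ 3 ℕ.* Y ℕ.+ u) ≡ (X ≡ᵇ Y)
lex-≡ᵇ-aligned X Y u = T-ext {3 ℕ.* X ℕ.+ u ≡ᵇ 3 ℕ.* Y ℕ.+ u}
  (λ p → ℕP.≡⇒≡ᵇ X Y (ℕP.*-cancelˡ-≡ X Y 3 (ℕP.+-cancelʳ-≡ u _ _ (ℕP.≡ᵇ⇒≡ _ _ p))))
  (λ p → ℕP.≡⇒≡ᵇ _ _ (cong (λ k → 3 ℕ.* k ℕ.+ u) (ℕP.≡ᵇ⇒≡ X Y p)))

lex-≡ᵇ-distinct : ∀ {u v} X Y → u ≢ v → u ℕ.< 3 → v ℕ.< 3 → (3 ℕ.* X ℕ.+ u ≡ᵇ 3 ℕ.* Y ℕ.+ v) ≡ false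
lex-≡ᵇ-distinct {u} {v} X Y u≢v u<3 v<3 = T-ext {3 ℕ.* X ℕ.+ u ≡ᵇ 3 ℕ.* Y ℕ.+ v} (λ p → distinct (ℕP.≡ᵇ⇒≡ _ _ p)) ⊥-elim
  where
  distinct : 3 ℕ.* X ℕ.+ u ≢ 3 ℕ.* Y ℕ.+ v
  distinct e with ℕP.<-cmp X Y
  ... | tri< X<Y _ _ = ℕP.<⇒≢ (lex-< X<Y u<3) e
  ... | tri≈ _ refl _ = u≢v (ℕP.+-cancelˡ-≡ (3 ℕ.* X) u v e)
  ... | tri> _ _ Y<X = ℕP.<⇒≢ (lex-< Y<X v<3) (sym e)

weight : ∀ {n} → Fin n → ℤ
weight i = + suc (toℕ i)

∑-weight-∑ : ∀ {m k} (f : Fin k → Fin m → ℤ) →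
             ∑[ i < m ] (weight i * ∑[ j < k ] f j i) ≡ ∑∑ (λ j i → weight i * f j i)
∑-weight-∑ f = trans (sum-cong-≗ (λ i → *-distribˡ-sum (weight i) (λ j → f j i)))
                     (∑-comm (λ i j → weight i * f j i))

weightedSum-orbits : ∀ {n s t} (δ : Divisor n s t) → weightedSum δ ≡
  ∑∑ (λ j i → weight i * δ (x j i)) + ∑∑ (λ j i → weight i * δ (y j i)) + ∑∑ (λ j i → weight i * δ (z j i))
weightedSum-orbits {n} {s} {t} δ = begin
  weightedSum δ
    ≡⟨ sumFin≡sum n _ ⟩
  ∑[ i < n ] (weight i * (Xs δ i + Ys δ i + Zs δ i))
    ≡⟨ sum-cong-≗ (λ i → trans (cong (weight i *_) (orbitSums i)) (*-distrib₃ (weight i) (X i) (Y i) (Z i))) ⟩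
  ∑[ i < n ] (weight i * X i + weight i * Y i + weight i * Z i)
    ≡⟨ trans (∑-distrib-+ (λ i → weight i * X i + weight i * Y i) (λ i → weight i * Z i))
             (cong (_+ ∑[ i < n ] (weight i * Z i)) (∑-distrib-+ (λ i → weight i * X i) (λ i → weight i * Y i))) ⟩
  ∑[ i < n ] (weight i * X i) + ∑[ i < n ] (weight i * Y i) + ∑[ i < n ] (weight i * Z i)
    ≡⟨ cong₂ _+_ (cong₂ _+_ (∑-weight-∑ (λ j i → δ (x j i))) (∑-weight-∑ (λ j i → δ (y j i))))
                 (∑-weight-∑ (λ j i → δ (z j i))) ⟩
  ∑∑ (λ j i → weight i * δ (x j i)) + ∑∑ (λ j i → weight i * δ (y j i)) + ∑∑ (λ j i → weight i * δ (z j i)) ∎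
  where
  open ≡-Reasoning
  X Y Z : Fin n → ℤ
  X i = ∑[ j < t ] δ (x j i)
  Y i = ∑[ j < t ] δ (y j i)
  Z i = ∑[ j < s ] δ (z j i)
  orbitSums : ∀ i → Xs δ i + Ys δ i + Zs δ i ≡ X i + Y i + Z i
  orbitSums i = cong₂ _+_ (cong₂ _+_ (sumFin≡sum t _) (sumFin≡sum t _)) (sumFin≡sum s _)
  *-distrib₃ : ∀ w a b c → w * (a + b + c) ≡ w * a + w * b + w * c
  *-distrib₃ w a b c = trans (ℤP.*-distribˡ-+ w (a + b) c) (cong (_+ w * c) (ℤP.*-distribˡ-+ w a b))

deg-+ : ∀ {n s t} {δ δ₁ δ₂ : Divisor n s t} → (∀ v → δ v ≡ δ₁ v + δ₂ v) → deg δ ≡ deg δ₁ + deg δ₂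
deg-+ {n} {s} {t} split = sumℤ-map-+ split (allV n s t)

degQuot-+* : ∀ {n s t} (τ : V n s t → V n s t) (D E : Divisor n s t) (k : ℤ) →
             degQuot τ (λ v → D v + k * E v) ≡ degQuot τ D + k * degQuot τ E
degQuot-+* {n} {s} {t} τ D E k = trans
  (sumℤ-map-+ (λ v → trans (when-+ (rep v) (D v) (k * E v)) (cong (_+_ (when (rep v) (D v))) (when-* (rep v) k (E v))))
              (allV n s t))
  (cong (_+_ (degQuot τ D)) (sumℤ-map-* k (λ v → when (rep v) (E v)) (allV n s t)))
  where
  rep : V n s t → Bool
  rep v = rank v ≤ᵇ rank (τ v)

weightedSum-+ : ∀ {n s t} {δ δ₁ δ₂ : Divisor n s t} → (∀ v → δ v ≡ δ₁ v + δ₂ v) →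
                weightedSum δ ≡ weightedSum δ₁ + weightedSum δ₂
weightedSum-+ {n} {s} {t} {δ} {δ₁} {δ₂} split = begin
  weightedSum δ
    ≡⟨ weightedSum-orbits δ ⟩
  W x δ + W y δ + W z δ
    ≡⟨ cong₂ _+_ (cong₂ _+_ (W-+ x) (W-+ y)) (W-+ z) ⟩
  (W x δ₁ + W x δ₂) + (W y δ₁ + W y δ₂) + (W z δ₁ + W z δ₂)
    ≡⟨ regroup (W x δ₁) (W x δ₂) (W y δ₁) (W y δ₂) (W z δ₁) (W z δ₂) ⟩
  (W x δ₁ + W y δ₁ + W z δ₁) + (W x δ₂ + W y δ₂ + W z δ₂)
    ≡⟨ sym (cong₂ _+_ (weightedSum-orbits δ₁) (weightedSum-orbits δ₂)) ⟩
  weightedSum δ₁ + weightedSum δ₂ ∎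
  where
  open ≡-Reasoning
  W : ∀ {m} → (Fin m → Fin n → V n s t) → Divisor n s t → ℤ
  W c d = ∑∑ (λ j i → weight i * d (c j i))
  W-+ : ∀ {m} (c : Fin m → Fin n → V n s t) → W c δ ≡ W c δ₁ + W c δ₂
  W-+ c = trans (∑∑-cong (λ j i → trans (cong (weight i *_) (split (c j i))) (ℤP.*-distribˡ-+ (weight i) (δ₁ (c j i)) (δ₂ (c j i)))))
                (∑∑-+ (λ j i → weight i * δ₁ (c j i)) (λ j i → weight i * δ₂ (c j i)))
  regroup : ∀ a a′ b b′ c c′ → (a + a′) + (b + b′) + (c + c′) ≡ (a + b + c) + (a′ + b′ + c′)
  regroup = solve-∀

∑∑-weights : ∀ {a b} {u e : Fin b → ℤ} (c m : ℤ) → (∀ i → u i ≡ c + m * e i) → (f : Fin a → Fin b → ℤ) →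
             ∑∑ (λ j i → u i * f j i) ≡ c * ∑∑ f + m * ∑∑ (λ j i → e i * f j i)
∑∑-weights {u = u} {e} c m u≡ f = begin
  ∑∑ (λ j i → u i * f j i)
    ≡⟨ ∑∑-cong (λ j i → trans (cong (_* f j i) (u≡ i)) (expand (e i) (f j i))) ⟩
  ∑∑ (λ j i → c * f j i + m * (e i * f j i))
    ≡⟨ ∑∑-+ (λ j i → c * f j i) (λ j i → m * (e i * f j i)) ⟩
  ∑∑ (λ j i → c * f j i) + ∑∑ (λ j i → m * (e i * f j i))
    ≡⟨ cong₂ _+_ (∑∑-* c f) (∑∑-* m (λ j i → e i * f j i)) ⟩
  c * ∑∑ f + m * ∑∑ (λ j i → e i * f j i) ∎
  where
  open ≡-Reasoning
  expand : ∀ e v → (c + m * e) * v ≡ c * v + m * (e * v)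
  expand e v = trans (ℤP.*-distribʳ-+ v c (m * e)) (cong (_+_ (c * v)) (ℤP.*-assoc m e v))

-- Pullbacks along G → G/⟨τ⟩

pullback : ∀ {n s t} → (V n s t → V n s t) → Divisor n s t → Divisor n s t
pullback τ D v = stab τ v * D v

module Pullback {n' s t : ℕ} (r : Fin (suc n') → Fin (suc n')) (r-involutive : ∀ i → r (r i) ≡ i)
  (τ : V (suc n') s t → V (suc n') s t)
  (τ-z : ∀ j i → τ (z j i) ≡ z j (r i))
  (τ-x : ∀ j i → τ (x j i) ≡ y j (r i))
  (τ-y : ∀ j i → τ (y j i) ≡ x j (r i)) where

  open Involution r r-involutive public

  private
    N = suc n'

    rank′ : V N s t → ℕ
    rank′ = rank

    position : ∀ {m} → Fin m → Fin N → ℕ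
    position j i = toℕ j ℕ.* N ℕ.+ toℕ i

    3*-≤ᵇ : ∀ X Y → (3 ℕ.* X ≤ᵇ 3 ℕ.* Y) ≡ (X ≤ᵇ Y)
    3*-≤ᵇ X Y = trans (sym (cong₂ _≤ᵇ_ (ℕP.+-identityʳ (3 ℕ.* X)) (ℕP.+-identityʳ (3 ℕ.* Y))))
                      (lex-≤ᵇ-aligned X Y ℕ.z≤n (ℕ.s≤s ℕ.z≤n))

    3*-≡ᵇ : ∀ X Y → (3 ℕ.* X ≡ᵇ 3 ℕ.* Y) ≡ (X ≡ᵇ Y)
    3*-≡ᵇ X Y = trans (sym (cong₂ _≡ᵇ_ (ℕP.+-identityʳ (3 ℕ.* X)) (ℕP.+-identityʳ (3 ℕ.* Y))))
                      (lex-≡ᵇ-aligned X Y 0)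

  isRep-z : ∀ j i → (rank′ (z j i) ≤ᵇ rank′ (τ (z j i))) ≡ IsRep i
  isRep-z j i = begin
    rank′ (z j i) ≤ᵇ rank′ (τ (z j i))                  ≡⟨ cong (λ v → rank′ (z j i) ≤ᵇ rank′ v) (τ-z j i) ⟩
    3 ℕ.* position j i ≤ᵇ 3 ℕ.* position j (r i)      ≡⟨ 3*-≤ᵇ (position j i) (position j (r i)) ⟩
    position j i ≤ᵇ position j (r i)                  ≡⟨ +-≤ᵇ-cancelˡ (toℕ j ℕ.* N) (toℕ i) (toℕ (r i)) ⟩
    IsRep i                                           ∎
    where open ≡-Reasoning

  isRep-x : ∀ j i → (rank′ (x j i) ≤ᵇ rank′ (τ (x j i))) ≡ IsRep i
  isRep-x j i = begin
    rank′ (x j i) ≤ᵇ rank′ (τ (x j i))                            ≡⟨ cong (λ v → rank′ (x j i) ≤ᵇ rank′ v) (τ-x j i) ⟩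
    3 ℕ.* position j i ℕ.+ 1 ≤ᵇ 3 ℕ.* position j (r i) ℕ.+ 2   ≡⟨ lex-≤ᵇ-aligned {1} {2} (position j i) (position j (r i)) (ℕ.s≤s ℕ.z≤n) ℕP.≤-refl ⟩
    position j i ≤ᵇ position j (r i)                            ≡⟨ +-≤ᵇ-cancelˡ (toℕ j ℕ.* N) (toℕ i) (toℕ (r i)) ⟩
    IsRep i                                                     ∎
    where open ≡-Reasoning

  isRep-y : ∀ j i → (rank′ (y j i) ≤ᵇ rank′ (τ (y j i))) ≡ (toℕ i <ᵇ toℕ (r i))
  isRep-y j i = begin
    rank′ (y j i) ≤ᵇ rank′ (τ (y j i))                            ≡⟨ cong (λ v → rank′ (y j i) ≤ᵇ rank′ v) (τ-y j i) ⟩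
    3 ℕ.* position j i ℕ.+ 2 ≤ᵇ 3 ℕ.* position j (r i) ℕ.+ 1   ≡⟨ lex-≤ᵇ-crossed {2} {1} (position j i) (position j (r i)) ℕP.≤-refl ℕP.≤-refl ⟩
    position j i <ᵇ position j (r i)                            ≡⟨ +-<ᵇ-cancelˡ (toℕ j ℕ.* N) (toℕ i) (toℕ (r i)) ⟩
    toℕ i <ᵇ toℕ (r i)                                          ∎
    where open ≡-Reasoning

  stab-z : ∀ j i → stab τ (z j i) ≡ stabFactor i
  stab-z j i = cong (λ b → if b then + 2 else + 1) (begin
    rank′ (τ (z j i)) ≡ᵇ rank′ (z j i)               ≡⟨ cong (λ v → rank′ v ≡ᵇ rank′ (z j i)) (τ-z j i) ⟩
    3 ℕ.* position j (r i) ≡ᵇ 3 ℕ.* position j i   ≡⟨ 3*-≡ᵇ (position j (r i)) (position j i) ⟩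
    position j (r i) ≡ᵇ position j i               ≡⟨ +-≡ᵇ-cancelˡ (toℕ j ℕ.* N) (toℕ (r i)) (toℕ i) ⟩
    IsFixed i                                      ∎)
    where open ≡-Reasoning

  stab-x : ∀ j i → stab τ (x j i) ≡ + 1
  stab-x j i = cong (λ b → if b then + 2 else + 1)
    (trans (cong (λ v → rank′ v ≡ᵇ rank′ (x j i)) (τ-x j i))
           (lex-≡ᵇ-distinct {2} {1} (position j (r i)) (position j i) (λ ()) ℕP.≤-refl (ℕ.s≤s (ℕ.s≤s ℕ.z≤n))))

  stab-y : ∀ j i → stab τ (y j i) ≡ + 1
  stab-y j i = cong (λ b → if b then + 2 else + 1)
    (trans (cong (λ v → rank′ v ≡ᵇ rank′ (y j i)) (τ-y j i))
           (lex-≡ᵇ-distinct {1} {2} (position j (r i)) (position j i) (λ ()) (ℕ.s≤s (ℕ.s≤s ℕ.z≤n)) ℕP.≤-refl))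

  module Invariant (D : Divisor N s t) (D-inv : InvariantUnder τ D) where

    D-z-∘r : ∀ j i → D (z j (r i)) ≡ D (z j i)
    D-z-∘r j i = trans (cong D (sym (τ-z j i))) (D-inv (z j i))

    D-y : ∀ j i → D (y j i) ≡ D (x j (r i))
    D-y j i = trans (cong (λ k → D (y j k)) (sym (r-involutive i)))
                    (trans (cong D (sym (τ-x j (r i)))) (D-inv (x j (r i))))

    repSumZ sumX : ℤ
    repSumZ = ∑∑ (λ j i → when (IsRep i) (D (z j i)))
    sumX    = ∑∑ (λ j i → D (x j i))

    degQuot-orbits : degQuot τ D ≡ repSumZ + sumX
    degQuot-orbits = begin
      degQuot τ D
        ≡⟨ sumℤ-allV (λ v → when (rank′ v ≤ᵇ rank′ (τ v)) (D v)) ⟩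
      _ ≡⟨ cong₂ _+_ (∑∑-cong (λ j i → cong (λ b → when b (D (z j i))) (isRep-z j i)))
                     (cong₂ _+_ (∑∑-cong (λ j i → cong (λ b → when b (D (x j i))) (isRep-x j i)))
                                (∑∑-cong (λ j i → cong₂ when (isRep-y j i) (D-y j i)))) ⟩
      repSumZ + (∑∑ (λ j i → when (IsRep i) (D (x j i)))
                 + ∑∑ (λ j i → when (toℕ i <ᵇ toℕ (r i)) (D (x j (r i)))))
        ≡⟨ cong (_+_ repSumZ) (trans (sym (∑∑-+ (λ j i → when (IsRep i) (D (x j i)))
                                                (λ j i → when (toℕ i <ᵇ toℕ (r i)) (D (x j (r i))))))
                                     (sum-cong-≗ (λ j →
                                        trans (∑-distrib-+ (λ i → when (IsRep i) (D (x j i)))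
                                                           (λ i → when (toℕ i <ᵇ toℕ (r i)) (D (x j (r i)))))
                                              (∑-orbits (λ i → D (x j i)))))) ⟩
      repSumZ + sumX ∎
      where open ≡-Reasoning

    pullback-z : ∀ j i → pullback τ D (z j i) ≡ stabFactor i * D (z j i)
    pullback-z j i = cong (_* D (z j i)) (stab-z j i)

    pullback-x : ∀ j i → pullback τ D (x j i) ≡ D (x j i)
    pullback-x j i = trans (cong (_* D (x j i)) (stab-x j i)) (ℤP.*-identityˡ (D (x j i)))

    pullback-y : ∀ j i → pullback τ D (y j i) ≡ D (x j (r i))
    pullback-y j i = trans (cong (_* D (y j i)) (stab-y j i)) (trans (ℤP.*-identityˡ (D (y j i))) (D-y j i))

    ∑-pullback-z : ∀ j → ∑[ i < N ] pullback τ D (z j i) ≡ + 2 * ∑[ i < N ] when (IsRep i) (D (z j i))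
    ∑-pullback-z j = begin
      ∑[ i < N ] pullback τ D (z j i)
        ≡⟨ sum-cong-≗ (λ i → trans (pullback-z j i) (sym (ℤP.*-identityˡ _))) ⟩
      ∑[ i < N ] (+ 1 * (stabFactor i * D (z j i)))
        ≡⟨ ∑-stabFactor (λ _ → + 1) (λ i → D (z j i)) (D-z-∘r j) ⟩
      ∑[ i < N ] (+ 2 * when (IsRep i) (D (z j i)))
        ≡⟨ sym (*-distribˡ-sum (+ 2) (λ i → when (IsRep i) (D (z j i)))) ⟩
      + 2 * ∑[ i < N ] when (IsRep i) (D (z j i)) ∎
      where open ≡-Reasoning

    ∑-pullback-x : ∀ j → ∑[ i < N ] pullback τ D (x j i) ≡ ∑[ i < N ] D (x j i)
    ∑-pullback-x j = sum-cong-≗ (pullback-x j)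

    ∑-pullback-y : ∀ j → ∑[ i < N ] pullback τ D (y j i) ≡ ∑[ i < N ] D (x j i)
    ∑-pullback-y j = trans (sum-cong-≗ (pullback-y j)) (sym (sum-∘r (λ i → D (x j i))))

    deg-pullback : deg (pullback τ D) ≡ + 2 * degQuot τ D
    deg-pullback = begin
      deg (pullback τ D)
        ≡⟨ sumℤ-allV (pullback τ D) ⟩
      _ ≡⟨ cong₂ _+_ (trans (sum-cong-≗ ∑-pullback-z) (sym (*-distribˡ-sum (+ 2) (λ j → ∑[ i < N ] when (IsRep i) (D (z j i))))))
                     (cong₂ _+_ (sum-cong-≗ ∑-pullback-x) (sum-cong-≗ ∑-pullback-y)) ⟩
      + 2 * repSumZ + (sumX + sumX)     ≡⟨ cong (_+_ (+ 2 * repSumZ)) (sym (2*-double sumX)) ⟩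
      + 2 * repSumZ + + 2 * sumX        ≡⟨ sym (ℤP.*-distribˡ-+ (+ 2) repSumZ sumX) ⟩
      + 2 * (repSumZ + sumX)            ≡⟨ cong (+ 2 *_) (sym degQuot-orbits) ⟩
      + 2 * degQuot τ D                 ∎
      where open ≡-Reasoning

    weightedSum-pullback : ∀ c {e : Fin N → ℤ} → (∀ i → weight i + weight (r i) ≡ c + + N * e i) →
                           Σ ℤ λ K → weightedSum (pullback τ D) ≡ c * degQuot τ D + + N * K
    weightedSum-pullback c {e} weights = Kx + Kz , (begin
      weightedSum (pullback τ D)
        ≡⟨ weightedSum-orbits (pullback τ D) ⟩
      _ ≡⟨ cong₂ _+_ xy-part z-part ⟩
      (c * sumX + + N * Kx) + (c * repSumZ + + N * Kz)
        ≡⟨ regroup c (+ N) sumX Kx repSumZ Kz ⟩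
      c * (repSumZ + sumX) + + N * (Kx + Kz)
        ≡⟨ cong (λ q → c * q + + N * (Kx + Kz)) (sym degQuot-orbits) ⟩
      c * degQuot τ D + + N * (Kx + Kz) ∎)
      where
      open ≡-Reasoning
      Kx Kz : ℤ
      Kx = ∑∑ (λ j i → e i * D (x j i))
      Kz = ∑∑ (λ j i → e i * when (IsRep i) (D (z j i)))

      regroup : ∀ c m X Kx Z Kz → (c * X + m * Kx) + (c * Z + m * Kz) ≡ c * (Z + X) + m * (Kx + Kz)
      regroup = solve-∀

      xy-part : ∑∑ (λ j i → weight i * pullback τ D (x j i)) + ∑∑ (λ j i → weight i * pullback τ D (y j i))
                ≡ c * sumX + + N * Kx
      xy-part = begin
        ∑∑ (λ j i → weight i * pullback τ D (x j i)) + ∑∑ (λ j i → weight i * pullback τ D (y j i))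
          ≡⟨ cong₂ _+_ (∑∑-cong (λ j i → cong (weight i *_) (pullback-x j i)))
                       (trans (∑∑-cong (λ j i → cong (weight i *_) (pullback-y j i)))
                              (sum-cong-≗ (λ j → trans (sum-∘r (λ i → weight i * D (x j (r i))))
                                (sum-cong-≗ (λ i → cong (λ k → weight (r i) * D (x j k)) (r-involutive i)))))) ⟩
        ∑∑ (λ j i → weight i * D (x j i)) + ∑∑ (λ j i → weight (r i) * D (x j i))
          ≡⟨ sym (∑∑-+ (λ j i → weight i * D (x j i)) (λ j i → weight (r i) * D (x j i))) ⟩
        ∑∑ (λ j i → weight i * D (x j i) + weight (r i) * D (x j i))
          ≡⟨ ∑∑-cong (λ j i → sym (ℤP.*-distribʳ-+ (D (x j i)) (weight i) (weight (r i)))) ⟩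
        ∑∑ (λ j i → (weight i + weight (r i)) * D (x j i))
          ≡⟨ ∑∑-weights c (+ N) weights (λ j i → D (x j i)) ⟩
        c * sumX + + N * Kx ∎

      z-part : ∑∑ (λ j i → weight i * pullback τ D (z j i)) ≡ c * repSumZ + + N * Kz
      z-part = begin
        ∑∑ (λ j i → weight i * pullback τ D (z j i))
          ≡⟨ ∑∑-cong (λ j i → cong (weight i *_) (pullback-z j i)) ⟩
        ∑∑ (λ j i → weight i * (stabFactor i * D (z j i)))
          ≡⟨ sum-cong-≗ (λ j → ∑-stabFactor weight (λ i → D (z j i)) (D-z-∘r j)) ⟩
        ∑∑ (λ j i → (weight i + weight (r i)) * when (IsRep i) (D (z j i)))
          ≡⟨ ∑∑-weights c (+ N) weights (λ j i → when (IsRep i) (D (z j i))) ⟩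
        c * repSumZ + + N * Kz ∎

module Involution₁ {n' : ℕ} = Involution (r₁ (suc n')) r₁-involutive
module Involution₂ {n' : ℕ} = Involution (r₂ (suc n')) r₂-involutive
module Pullback₁ {n' s t : ℕ} = Pullback {n'} {s} {t} (r₁ (suc n')) r₁-involutive σ₁ (λ _ _ → refl) (λ _ _ → refl) (λ _ _ → refl)
module Pullback₂ {n' s t : ℕ} = Pullback {n'} {s} {t} (r₂ (suc n')) r₂-involutive σ₂ (λ _ _ → refl) (λ _ _ → refl) (λ _ _ → refl)

weight+weight∘r₁ : ∀ {n'} (i : Fin (suc n')) → weight i + weight (r₁ (suc n') i) ≡ + 1 + + suc n' * + 1
weight+weight∘r₁ {n'} i = begin
  + (suc (toℕ i) ℕ.+ suc (toℕ (r₁ (suc n') i))) ≡⟨ cong (λ k → + (suc (toℕ i) ℕ.+ k)) (suc-toℕ-r₁ i) ⟩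
  + suc (toℕ i ℕ.+ (suc n' ∸ toℕ i))            ≡⟨ cong (λ k → + suc k) (ℕP.m+[n∸m]≡n (FinP.toℕ≤n i)) ⟩
  + 1 + + suc n'                                ≡⟨ cong (_+_ (+ 1)) (sym (ℤP.*-identityʳ (+ suc n'))) ⟩
  + 1 + + suc n' * + 1                          ∎
  where open ≡-Reasoning

ifNonzero : ∀ {n} → Fin n → ℤ
ifNonzero Fin.zero    = 0ℤ
ifNonzero (Fin.suc _) = + 1

weight+weight∘r₂ : ∀ {n'} (i : Fin (suc n')) → weight i + weight (r₂ (suc n') i) ≡ + 2 + + suc n' * ifNonzero i
weight+weight∘r₂ {n'} Fin.zero = begin
  + 1 + weight (r₂ (suc n') Fin.zero) ≡⟨ cong (λ k → + 1 + weight k) r₂-zero ⟩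
  + 2                                 ≡⟨ sym (ℤP.+-identityʳ (+ 2)) ⟩
  + 2 + 0ℤ                            ≡⟨ cong (_+_ (+ 2)) (sym (ℤP.*-zeroʳ (+ suc n'))) ⟩
  + 2 + + suc n' * 0ℤ                 ∎
  where open ≡-Reasoning
weight+weight∘r₂ {n'} i@(Fin.suc k) = begin
  + (suc (toℕ i) ℕ.+ suc (toℕ (r₂ (suc n') i))) ≡⟨ cong (λ m → + (suc (toℕ i) ℕ.+ suc m)) (toℕ-r₂ i ℕ.z<s) ⟩
  + (suc (toℕ i) ℕ.+ suc (suc n' ∸ toℕ i))      ≡⟨ cong (λ m → + suc m) (ℕP.+-suc (toℕ i) (suc n' ∸ toℕ i)) ⟩
  + suc (suc (toℕ i ℕ.+ (suc n' ∸ toℕ i)))      ≡⟨ cong (λ m → + suc (suc m)) (ℕP.m+[n∸m]≡n (FinP.toℕ≤n i)) ⟩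
  + 2 + + suc n'                                ≡⟨ cong (_+_ (+ 2)) (sym (ℤP.*-identityʳ (+ suc n'))) ⟩
  + 2 + + suc n' * + 1                          ∎
  where open ≡-Reasoning

-- Splitting a single orbit

∑-distrib-- : ∀ {n} (f g : Fin n → ℤ) → ∑[ i < n ] (f i - g i) ≡ sum f - sum g
∑-distrib-- f g = begin
  ∑[ i < _ ] (f i - g i)            ≡⟨ ∑-distrib-+ f (λ i → - g i) ⟩
  sum f + ∑[ i < _ ] (- g i)        ≡⟨ cong (_+_ (sum f)) (sum-cong-≗ (λ i → sym (ℤP.-1*i≡-i (g i)))) ⟩
  sum f + ∑[ i < _ ] (ℤ.-1ℤ * g i)  ≡⟨ cong (_+_ (sum f)) (sym (*-distribˡ-sum ℤ.-1ℤ g)) ⟩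
  sum f + ℤ.-1ℤ * sum g             ≡⟨ cong (_+_ (sum f)) (ℤP.-1*i≡-i (sum g)) ⟩
  sum f - sum g                     ∎
  where open ≡-Reasoning

∑-when-≡ᵇ : ∀ {n} (f : Fin n → ℤ) i → ∑[ m < n ] when (toℕ m ≡ᵇ toℕ i) (f m) ≡ f i
∑-when-≡ᵇ {suc n} f Fin.zero    = trans (cong (_+_ (f Fin.zero)) (sum-replicate-zero n)) (ℤP.+-identityʳ _)
∑-when-≡ᵇ {suc n} f (Fin.suc i) = trans (ℤP.+-identityˡ _) (∑-when-≡ᵇ (f ∘ Fin.suc) i)

when-<ᵇ-suc : ∀ a k v → when (a <ᵇ suc k) v ≡ when (a <ᵇ k) v + when (a ≡ᵇ k) v
when-<ᵇ-suc zero    zero    v = sym (ℤP.+-identityˡ v)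
when-<ᵇ-suc zero    (suc k) v = sym (ℤP.+-identityʳ v)
when-<ᵇ-suc (suc a) zero    v = refl
when-<ᵇ-suc (suc a) (suc k) v = when-<ᵇ-suc a k v

prefix : ∀ {n} → (Fin n → ℤ) → ℕ → ℤ
prefix {n} f k = ∑[ m < n ] when (toℕ m <ᵇ k) (f m)

prefix-zero : ∀ {n} (f : Fin n → ℤ) → prefix f 0 ≡ 0ℤ
prefix-zero {n} f = trans (sum-cong-≗ (λ m → cong (λ b → when b (f m)) (<ᵇ-zero (toℕ m)))) (sum-replicate-zero n)
  where
  <ᵇ-zero : ∀ a → (a <ᵇ 0) ≡ false
  <ᵇ-zero zero    = refl
  <ᵇ-zero (suc a) = refl

prefix-full : ∀ {n} (f : Fin n → ℤ) → prefix f n ≡ sum f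
prefix-full {n} f = sum-cong-≗ (λ m → when-T {toℕ m <ᵇ n} {f m} (ℕP.<⇒<ᵇ (FinP.toℕ<n m)))
  where
  when-T : ∀ {b v} → T b → when b v ≡ v
  when-T {true} _ = refl

prefix-suc : ∀ {n} (f : Fin n → ℤ) i → prefix f (suc (toℕ i)) ≡ prefix f (toℕ i) + f i
prefix-suc {n} f i = begin
  prefix f (suc (toℕ i))
    ≡⟨ sum-cong-≗ (λ m → when-<ᵇ-suc (toℕ m) (toℕ i) (f m)) ⟩
  ∑[ m < n ] (when (toℕ m <ᵇ toℕ i) (f m) + when (toℕ m ≡ᵇ toℕ i) (f m))
    ≡⟨ ∑-distrib-+ (λ m → when (toℕ m <ᵇ toℕ i) (f m)) (λ m → when (toℕ m ≡ᵇ toℕ i) (f m)) ⟩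
  prefix f (toℕ i) + ∑[ m < n ] when (toℕ m ≡ᵇ toℕ i) (f m)
    ≡⟨ cong (_+_ (prefix f (toℕ i))) (∑-when-≡ᵇ f i) ⟩
  prefix f (toℕ i) + f i ∎
  where open ≡-Reasoning

telescoped : ∀ {n} → (Fin n → ℤ) → Fin n → ℤ
telescoped h i = prefix h (suc (toℕ i))

-- r₁ ∘ r₂ is the cyclic predecessor i ↦ i - 1; the wrap-around step at i = 0 is where Σ h = 0 is used.
telescoped-step : ∀ {n'} (h : Fin (suc n') → ℤ) → sum h ≡ 0ℤ →
                  ∀ i → telescoped h i ≡ telescoped h (r₁ (suc n') (r₂ (suc n') i)) + h i
telescoped-step {n'} h sum≡0 Fin.zero = begin
  prefix h 1                 ≡⟨ prefix-suc h Fin.zero ⟩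
  prefix h 0 + h Fin.zero    ≡⟨ cong (_+ h Fin.zero) wrapsAround ⟩
  telescoped h (r₁ (suc n') (r₂ (suc n') Fin.zero)) + h Fin.zero ∎
  where
  open ≡-Reasoning
  wrapsAround : prefix h 0 ≡ telescoped h (r₁ (suc n') (r₂ (suc n') Fin.zero))
  wrapsAround = begin
    prefix h 0                         ≡⟨ prefix-zero h ⟩
    0ℤ                                 ≡⟨ sym sum≡0 ⟩
    sum h                              ≡⟨ sym (prefix-full h) ⟩
    prefix h (suc n')                  ≡⟨ cong (λ k → prefix h (suc k))
                                            (sym (trans (cong (toℕ ∘ r₁ (suc n')) r₂-zero) (toℕ-r₁ Fin.zero))) ⟩
    telescoped h (r₁ (suc n') (r₂ (suc n') Fin.zero)) ∎
telescoped-step {n'} h sum≡0 i@(Fin.suc k) = begin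
  prefix h (suc (toℕ i))            ≡⟨ prefix-suc h i ⟩
  prefix h (suc (toℕ k)) + h i      ≡⟨ cong (λ m → prefix h (suc m) + h i) (sym (toℕ-r₁∘r₂-suc k)) ⟩
  telescoped h (r₁ (suc n') (r₂ (suc n') i)) + h i ∎
  where open ≡-Reasoning

record PairSplitting {n'} (a b : Fin (suc n') → ℤ) : Set where
  field
    d₁ d₂    : Fin (suc n') → ℤ
    splits-x : ∀ i → a i ≡ d₁ i + d₂ i
    splits-y : ∀ i → b i ≡ d₁ (r₁ (suc n') i) + d₂ (r₂ (suc n') i)

pairSplitting : ∀ {n'} (a b : Fin (suc n') → ℤ) → sum a ≡ sum b → PairSplitting a b
pairSplitting {n'} a b sum-a≡sum-b = record
  { d₁ = p ; d₂ = λ i → a i - p i ; splits-x = λ i → a≡p+[a-p] (a i) (p i) ; splits-y = splits-y }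
  where
  N = suc n'
  h : Fin N → ℤ
  h i = a i - b (r₂ N i)
  p : Fin N → ℤ
  p = telescoped h

  sum-h : sum h ≡ 0ℤ
  sum-h = begin
    sum h                                  ≡⟨ ∑-distrib-- a (b ∘ r₂ N) ⟩
    sum a - sum (b ∘ r₂ N)                 ≡⟨ cong₂ _-_ sum-a≡sum-b (sym (Involution₂.sum-∘r b)) ⟩
    sum b - sum b                          ≡⟨ ℤP.+-inverseʳ (sum b) ⟩
    0ℤ                                     ∎
    where open ≡-Reasoning

  a≡p+[a-p] : ∀ a p → a ≡ p + (a - p)
  a≡p+[a-p] = solve-∀

  solve-for-b : ∀ a b p q → p ≡ q + (a - b) → b ≡ q + (a - p)
  solve-for-b a b p q e = trans (identity a b q) (cong (λ u → q + (a - u)) (sym e))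
    where
    identity : ∀ a b q → b ≡ q + (a - (q + (a - b)))
    identity = solve-∀

  splits-y : ∀ i → b i ≡ p (r₁ N i) + (a (r₂ N i) - p (r₂ N i))
  splits-y i = solve-for-b (a (r₂ N i)) (b i) (p (r₂ N i)) (p (r₁ N i)) (begin
    p (r₂ N i)                                       ≡⟨ telescoped-step h sum-h (r₂ N i) ⟩
    p (r₁ N (r₂ N (r₂ N i))) + h (r₂ N i)            ≡⟨ cong (λ k → p (r₁ N k) + (a (r₂ N i) - b k)) (r₂-involutive i) ⟩
    p (r₁ N i) + (a (r₂ N i) - b i)                  ∎)
    where open ≡-Reasoning

record OrbitSplitting {n'} (c : Fin (suc n') → ℤ) : Set where
  field
    d₁ d₂  : Fin (suc n') → ℤ
    d₁-∘r₁ : ∀ i → d₁ (r₁ (suc n') i) ≡ d₁ i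
    d₂-∘r₂ : ∀ i → d₂ (r₂ (suc n') i) ≡ d₂ i
    splits : ∀ i → c i ≡ Involution₁.stabFactor i * d₁ i + Involution₂.stabFactor i * d₂ i

-- With B = prefix c, take α i = B (i + 1) + B (N - i) - Σc, which is r₁-symmetric, and β = c - α,
-- which equals Σc - B i - B (N - i) and is therefore r₂-symmetric.  At fixed points both are
-- differences of two equal terms from the even total Σc = 2q, so they can be halved.
orbitSplitting : ∀ {n'} (c : Fin (suc n') → ℤ) → + 2 Signed.∣ sum c → OrbitSplitting c
orbitSplitting {n'} c (Signed.divides q sum-c≡q*2) = record
  { d₁ = Involution₁.halvedAtFixed α½ α
  ; d₂ = Involution₂.halvedAtFixed β½ β
  ; d₁-∘r₁ = Involution₁.halvedAtFixed-∘r α½ α α-∘r₁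
  ; d₂-∘r₂ = Involution₂.halvedAtFixed-∘r β½ β β-∘r₂
  ; splits = λ i → trans (c≡α+β i) (sym (cong₂ _+_
      (Involution₁.stabFactor-halvedAtFixed α½ α i (α-halves i))
      (Involution₂.stabFactor-halvedAtFixed β½ β i (β-halves i))))
  }
  where
  N = suc n'
  B = prefix c

  α α½ β β½ : Fin N → ℤ
  α i  = B (suc (toℕ i)) + B (N ∸ toℕ i) - + 2 * q
  α½ i = B (suc (toℕ i)) - q
  β i  = c i - α i
  β½ Fin.zero    = 0ℤ
  β½ (Fin.suc k) = q - B (suc (toℕ k))

  c≡α+β : ∀ i → c i ≡ α i + β i
  c≡α+β i = solve (c i) (α i)
    where
    solve : ∀ c a → c ≡ a + (c - a)
    solve = solve-∀

  α-∘r₁ : ∀ i → α (r₁ N i) ≡ α i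
  α-∘r₁ i = begin
    B (suc (toℕ (r₁ N i))) + B (N ∸ toℕ (r₁ N i)) - + 2 * q
      ≡⟨ cong₂ (λ u v → B u + B v - + 2 * q) (suc-toℕ-r₁ i) (∸-toℕ-r₁ i) ⟩
    B (N ∸ toℕ i) + B (suc (toℕ i)) - + 2 * q
      ≡⟨ cong (_- + 2 * q) (ℤP.+-comm (B (N ∸ toℕ i)) (B (suc (toℕ i)))) ⟩
    α i ∎
    where open ≡-Reasoning

  β-formula : ∀ i → β i ≡ + 2 * q - (B (toℕ i) + B (N ∸ toℕ i))
  β-formula i = trans (cong (λ u → c i - (u + B (N ∸ toℕ i) - + 2 * q)) (prefix-suc c i))
                      (solve (c i) (B (toℕ i)) (B (N ∸ toℕ i)) (+ 2 * q))
    where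
    solve : ∀ c b b′ t → c - (b + c + b′ - t) ≡ t - (b + b′)
    solve = solve-∀

  β-∘r₂ : ∀ i → β (r₂ N i) ≡ β i
  β-∘r₂ Fin.zero      = cong β r₂-zero
  β-∘r₂ i@(Fin.suc _) = begin
    β (r₂ N i)                                                 ≡⟨ β-formula (r₂ N i) ⟩
    + 2 * q - (B (toℕ (r₂ N i)) + B (N ∸ toℕ (r₂ N i)))        ≡⟨ cong₂ (λ u v → + 2 * q - (B u + B v)) (toℕ-r₂ i ℕ.z<s) (∸-toℕ-r₂ i ℕ.z<s) ⟩
    + 2 * q - (B (N ∸ toℕ i) + B (toℕ i))                      ≡⟨ cong (λ u → + 2 * q - u) (ℤP.+-comm (B (N ∸ toℕ i)) (B (toℕ i))) ⟩
    + 2 * q - (B (toℕ i) + B (N ∸ toℕ i))                      ≡⟨ sym (β-formula i) ⟩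
    β i                                                        ∎
    where open ≡-Reasoning

  α-halves : ∀ i → T (Involution₁.IsFixed i) → + 2 * α½ i ≡ α i
  α-halves i fixed = begin
    + 2 * (B (suc (toℕ i)) - q)                        ≡⟨ solve (B (suc (toℕ i))) q ⟩
    B (suc (toℕ i)) + B (suc (toℕ i)) - + 2 * q        ≡⟨ cong (λ k → B (suc (toℕ i)) + B k - + 2 * q) N∸i≡suc-i ⟩
    α i                                                ∎
    where
    open ≡-Reasoning
    solve : ∀ b q → + 2 * (b - q) ≡ b + b - + 2 * q
    solve = solve-∀
    N∸i≡suc-i : suc (toℕ i) ≡ N ∸ toℕ i
    N∸i≡suc-i = trans (cong suc (sym (ℕP.≡ᵇ⇒≡ _ _ fixed))) (suc-toℕ-r₁ i)

  β-halves : ∀ i → T (Involution₂.IsFixed i) → + 2 * β½ i ≡ β i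
  β-halves Fin.zero _ = sym (begin
    β Fin.zero                             ≡⟨ β-formula Fin.zero ⟩
    + 2 * q - (B 0 + B N)                  ≡⟨ cong₂ (λ u v → + 2 * q - (u + v)) (prefix-zero c) (trans (prefix-full c) sum-c≡q*2) ⟩
    + 2 * q - (0ℤ + q * + 2)               ≡⟨ solve q ⟩
    + 2 * 0ℤ                               ∎)
    where
    open ≡-Reasoning
    solve : ∀ q → + 2 * q - (0ℤ + q * + 2) ≡ + 2 * 0ℤ
    solve = solve-∀
  β-halves i@(Fin.suc k) fixed = begin
    + 2 * (q - B (toℕ i))                      ≡⟨ solve q (B (toℕ i)) ⟩
    + 2 * q - (B (toℕ i) + B (toℕ i))          ≡⟨ cong (λ m → + 2 * q - (B (toℕ i) + B m)) i≡N∸i ⟩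
    + 2 * q - (B (toℕ i) + B (N ∸ toℕ i))      ≡⟨ sym (β-formula i) ⟩
    β i                                        ∎
    where
    open ≡-Reasoning
    solve : ∀ q b → + 2 * (q - b) ≡ + 2 * q - (b + b)
    solve = solve-∀
    i≡N∸i : toℕ i ≡ N ∸ toℕ i
    i≡N∸i = trans (sym (ℕP.≡ᵇ⇒≡ _ _ fixed)) (toℕ-r₂ i ℕ.z<s)


-- Splitting δ into two pullbacks

module _ {n' s t : ℕ} where

  private
    N = suc n'
    module P₁ = Pullback₁ {n'} {s} {t}
    module P₂ = Pullback₂ {n'} {s} {t}

  record Splitting (δ : Divisor N s t) : Set where
    field
      D₁ D₂  : Divisor N s t
      D₁-inv : InvariantUnder σ₁ D₁
      D₂-inv : InvariantUnder σ₂ D₂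
      splits : ∀ v → δ v ≡ pullback σ₁ D₁ v + pullback σ₂ D₂ v

  IsBalanced : ∀ {δ} → Splitting δ → Set
  IsBalanced sp = degQuot σ₁ (Splitting.D₁ sp) ≡ 0ℤ × degQuot σ₂ (Splitting.D₂ sp) ≡ 0ℤ

  module _ {δ : Divisor N s t} (sp : Splitting δ) where
    open Splitting sp

    private
      module I₁ = P₁.Invariant D₁ D₁-inv
      module I₂ = P₂.Invariant D₂ D₂-inv

      ∑-splits : (f : Fin N → V N s t) →
                 ∑[ i < N ] δ (f i) ≡ ∑[ i < N ] pullback σ₁ D₁ (f i) + ∑[ i < N ] pullback σ₂ D₂ (f i)
      ∑-splits f = trans (sum-cong-≗ (λ i → splits (f i)))
                         (∑-distrib-+ (λ i → pullback σ₁ D₁ (f i)) (λ i → pullback σ₂ D₂ (f i)))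

    deg-splitting : deg δ ≡ + 2 * (degQuot σ₁ D₁ + degQuot σ₂ D₂)
    deg-splitting = trans (deg-+ {δ₁ = pullback σ₁ D₁} {δ₂ = pullback σ₂ D₂} splits)
      (trans (cong₂ _+_ I₁.deg-pullback I₂.deg-pullback) (sym (ℤP.*-distribˡ-+ (+ 2) (degQuot σ₁ D₁) (degQuot σ₂ D₂))))

    weightedSum-splitting : Σ ℤ λ K → weightedSum δ ≡ degQuot σ₁ D₁ + + 2 * degQuot σ₂ D₂ + + N * K
    weightedSum-splitting = combine (I₁.weightedSum-pullback (+ 1) {λ _ → + 1} weight+weight∘r₁)
                                    (I₂.weightedSum-pullback (+ 2) {ifNonzero} weight+weight∘r₂)
      where
      q₁ = degQuot σ₁ D₁
      q₂ = degQuot σ₂ D₂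
      regroup : ∀ q₁ q₂ m K₁ K₂ → (+ 1 * q₁ + m * K₁) + (+ 2 * q₂ + m * K₂) ≡ q₁ + + 2 * q₂ + m * (K₁ + K₂)
      regroup = solve-∀
      combine : (Σ ℤ λ K → weightedSum (pullback σ₁ D₁) ≡ + 1 * q₁ + + N * K) →
                (Σ ℤ λ K → weightedSum (pullback σ₂ D₂) ≡ + 2 * q₂ + + N * K) →
                Σ ℤ λ K → weightedSum δ ≡ q₁ + + 2 * q₂ + + N * K
      combine (K₁ , ws₁) (K₂ , ws₂) = K₁ + K₂ ,
        trans (weightedSum-+ {δ₁ = pullback σ₁ D₁} {δ₂ = pullback σ₂ D₂} splits)
              (trans (cong₂ _+_ ws₁ ws₂) (regroup q₁ q₂ (+ N) K₁ K₂))

    degQuots-cancel : deg δ ≡ 0ℤ → degQuot σ₁ D₁ + degQuot σ₂ D₂ ≡ 0ℤ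
    degQuots-cancel deg≡0 =
      ℤP.*-cancelˡ-≡ (+ 2) _ 0ℤ (trans (sym deg-splitting) (trans deg≡0 (sym (ℤP.*-zeroʳ (+ 2)))))

    ∑x≡∑y : ∀ j → ∑[ i < N ] δ (x j i) ≡ ∑[ i < N ] δ (y j i)
    ∑x≡∑y j = begin
      ∑[ i < N ] δ (x j i)
        ≡⟨ ∑-splits (x j) ⟩
      ∑[ i < N ] pullback σ₁ D₁ (x j i) + ∑[ i < N ] pullback σ₂ D₂ (x j i)
        ≡⟨ cong₂ _+_ (trans (I₁.∑-pullback-x j) (sym (I₁.∑-pullback-y j)))
                     (trans (I₂.∑-pullback-x j) (sym (I₂.∑-pullback-y j))) ⟩
      ∑[ i < N ] pullback σ₁ D₁ (y j i) + ∑[ i < N ] pullback σ₂ D₂ (y j i)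
        ≡⟨ sym (∑-splits (y j)) ⟩
      ∑[ i < N ] δ (y j i) ∎
      where open ≡-Reasoning

    ∑z-even : ∀ j → + 2 Signed.∣ ∑[ i < N ] δ (z j i)
    ∑z-even j = Signed.divides (R₁ + R₂) (begin
      ∑[ i < N ] δ (z j i)      ≡⟨ ∑-splits (z j) ⟩
      _                         ≡⟨ cong₂ _+_ (I₁.∑-pullback-z j) (I₂.∑-pullback-z j) ⟩
      + 2 * R₁ + + 2 * R₂       ≡⟨ regroup R₁ R₂ ⟩
      (R₁ + R₂) * + 2           ∎)
      where
      open ≡-Reasoning
      R₁ = ∑[ i < N ] when (P₁.IsRep i) (D₁ (z j i))
      R₂ = ∑[ i < N ] when (P₂.IsRep i) (D₂ (z j i))
      regroup : ∀ a b → + 2 * a + + 2 * b ≡ (a + b) * + 2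
      regroup = solve-∀

  splittingOf : (δ : Divisor N s t) → (∀ j → ∑[ i < N ] δ (x j i) ≡ ∑[ i < N ] δ (y j i)) →
                (∀ j → + 2 Signed.∣ ∑[ i < N ] δ (z j i)) → Splitting δ
  splittingOf δ ∑x≡∑y ∑z-even = record
    { D₁ = D₁ ; D₂ = D₂ ; D₁-inv = D₁-inv ; D₂-inv = D₂-inv ; splits = splits }
    where
    module Pair  (j : Fin t) = PairSplitting  (pairSplitting (λ i → δ (x j i)) (λ i → δ (y j i)) (∑x≡∑y j))
    module Orbit (j : Fin s) = OrbitSplitting (orbitSplitting (λ i → δ (z j i)) (∑z-even j))

    D₁ D₂ : Divisor N s t
    D₁ (z j i) = Orbit.d₁ j i
    D₁ (x j i) = Pair.d₁ j i
    D₁ (y j i) = Pair.d₁ j (r₁ N i)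
    D₂ (z j i) = Orbit.d₂ j i
    D₂ (x j i) = Pair.d₂ j i
    D₂ (y j i) = Pair.d₂ j (r₂ N i)

    D₁-inv : InvariantUnder σ₁ D₁
    D₁-inv (z j i) = Orbit.d₁-∘r₁ j i
    D₁-inv (x j i) = cong (Pair.d₁ j) (r₁-involutive i)
    D₁-inv (y j i) = refl

    D₂-inv : InvariantUnder σ₂ D₂
    D₂-inv (z j i) = Orbit.d₂-∘r₂ j i
    D₂-inv (x j i) = cong (Pair.d₂ j) (r₂-involutive i)
    D₂-inv (y j i) = refl

    unit-stabs : ∀ (v : V N s t) a b → stab σ₁ v ≡ + 1 → stab σ₂ v ≡ + 1 → a + b ≡ stab σ₁ v * a + stab σ₂ v * b
    unit-stabs v a b s₁≡1 s₂≡1 = sym (cong₂ _+_ (trans (cong (_* a) s₁≡1) (ℤP.*-identityˡ a))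
                                                (trans (cong (_* b) s₂≡1) (ℤP.*-identityˡ b)))

    splits : ∀ v → δ v ≡ pullback σ₁ D₁ v + pullback σ₂ D₂ v
    splits (z j i) = trans (Orbit.splits j i) (sym (cong₂ _+_ (cong (_* D₁ (z j i)) (P₁.stab-z j i))
                                                               (cong (_* D₂ (z j i)) (P₂.stab-z j i))))
    splits (x j i) = trans (Pair.splits-x j i) (unit-stabs (x j i) (D₁ (x j i)) (D₂ (x j i)) (P₁.stab-x j i) (P₂.stab-x j i))
    splits (y j i) = trans (Pair.splits-y j i) (unit-stabs (y j i) (D₁ (y j i)) (D₂ (y j i)) (P₁.stab-y j i) (P₂.stab-y j i))

  -- Multiples of a common pullback can be moved between D₁ and D₂ without changing δ.
  record CommonPullback : Set where
    field
      E₁ E₂         : Divisor N s t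
      E₁-inv        : InvariantUnder σ₁ E₁
      E₂-inv        : InvariantUnder σ₂ E₂
      same-pullback : ∀ v → pullback σ₁ E₁ v ≡ pullback σ₂ E₂ v
      degQuot-E₁    : degQuot σ₁ E₁ ≡ + N

  module _ (cp : CommonPullback) where
    open CommonPullback cp

    shift : ℤ → ∀ {δ} → Splitting δ → Splitting δ
    shift k sp = record
      { D₁ = λ v → D₁ v + k * E₁ v
      ; D₂ = λ v → D₂ v + - k * E₂ v
      ; D₁-inv = λ v → cong₂ (λ a b → a + k * b) (D₁-inv v) (E₁-inv v)
      ; D₂-inv = λ v → cong₂ (λ a b → a + - k * b) (D₂-inv v) (E₂-inv v)
      ; splits = λ v → trans (splits v) (transfer (stab σ₁ v) (stab σ₂ v) (D₁ v) (D₂ v) (E₁ v) (E₂ v) k (same-pullback v))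
      }
      where
      open Splitting sp
      transfer : ∀ s₁ s₂ d₁ d₂ e₁ e₂ k → s₁ * e₁ ≡ s₂ * e₂ →
                 s₁ * d₁ + s₂ * d₂ ≡ s₁ * (d₁ + k * e₁) + s₂ * (d₂ + - k * e₂)
      transfer s₁ s₂ d₁ d₂ e₁ e₂ k e = sym (trans (expand s₁ s₂ d₁ d₂ e₁ e₂ k)
        (trans (cong (λ u → s₁ * d₁ + s₂ * d₂ + k * u - k * (s₂ * e₂)) e) (cancel (s₁ * d₁ + s₂ * d₂) (k * (s₂ * e₂)))))
        where
        expand : ∀ s₁ s₂ d₁ d₂ e₁ e₂ k → s₁ * (d₁ + k * e₁) + s₂ * (d₂ + - k * e₂)
                                         ≡ s₁ * d₁ + s₂ * d₂ + k * (s₁ * e₁) - k * (s₂ * e₂)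
        expand = solve-∀
        cancel : ∀ a b → a + b - b ≡ a
        cancel = solve-∀

    -- deg δ = 0 forces q₁ + q₂ = 0, and then the weighted sum is ≡ q₁ + 2q₂ = -q₁ (mod N),
    -- so N ∣ q₁ and shifting by a multiple of the common pullback makes q₁ vanish.
    balanceWith : ∀ {δ} → Splitting δ → deg δ ≡ 0ℤ → + N Signed.∣ weightedSum δ → Σ (Splitting δ) IsBalanced
    balanceWith {δ} sp deg≡0 (Signed.divides Q ws≡Q*N) = shifted , q₁′≡0 , q₂′≡0
      where
      open Splitting sp
      q₁ = degQuot σ₁ D₁
      q₂ = degQuot σ₂ D₂
      K = proj₁ (weightedSum-splitting sp)
      k = Q - K
      shifted = shift k sp

      q₁+kN≡0 : q₁ + k * + N ≡ 0ℤ
      q₁+kN≡0 = begin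
        q₁ + (Q - K) * + N
          ≡⟨ identity q₁ q₂ Q K (+ N) ⟩
        + 2 * (q₁ + q₂) + (Q * + N - (q₁ + + 2 * q₂ + + N * K))
          ≡⟨ cong₂ (λ a b → + 2 * a + (Q * + N - b)) (degQuots-cancel sp deg≡0)
                   (trans (sym (proj₂ (weightedSum-splitting sp))) ws≡Q*N) ⟩
        + 2 * 0ℤ + (Q * + N - Q * + N)
          ≡⟨ vanish (Q * + N) ⟩
        0ℤ ∎
        where
        open ≡-Reasoning
        identity : ∀ q₁ q₂ Q K m → q₁ + (Q - K) * m ≡ + 2 * (q₁ + q₂) + (Q * m - (q₁ + + 2 * q₂ + m * K))
        identity = solve-∀
        vanish : ∀ a → + 2 * 0ℤ + (a - a) ≡ 0ℤ
        vanish = solve-∀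

      q₁′≡0 : degQuot σ₁ (Splitting.D₁ shifted) ≡ 0ℤ
      q₁′≡0 = trans (degQuot-+* σ₁ D₁ E₁ k) (trans (cong (λ e → q₁ + k * e) degQuot-E₁) q₁+kN≡0)

      q₂′≡0 : degQuot σ₂ (Splitting.D₂ shifted) ≡ 0ℤ
      q₂′≡0 = trans (sym (ℤP.+-identityˡ _))
                    (trans (cong (_+ degQuot σ₂ (Splitting.D₂ shifted)) (sym q₁′≡0)) (degQuots-cancel shifted deg≡0))

ifZero : ∀ {n} → Fin n → ℤ
ifZero Fin.zero    = + 1
ifZero (Fin.suc _) = 0ℤ

∑-one : ∀ n → ∑[ i < n ] (+ 1) ≡ + n
∑-one zero    = refl
∑-one (suc n) = cong (_+_ (+ 1)) (∑-one n)

∑∑-zero : ∀ a b → ∑∑ {a} {b} (λ _ _ → 0ℤ) ≡ 0ℤ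
∑∑-zero zero    b = refl
∑∑-zero (suc a) b = cong₂ _+_ (sum-replicate-zero b) (∑∑-zero a b)

∑∑-ifZero : ∀ {a} b → ∑∑ {suc a} {b} (λ j _ → ifZero j) ≡ + b
∑∑-ifZero {a} b = trans (cong₂ _+_ (∑-one b) (∑∑-zero a b)) (ℤP.+-identityʳ (+ b))

xCommonPullback : ∀ {n' s t'} → CommonPullback {n'} {s} {suc t'}
xCommonPullback {n'} {s} {t'} = record
  { E₁ = E ; E₂ = E ; E₁-inv = E-inv₁ ; E₂-inv = E-inv₂ ; same-pullback = same-pullback ; degQuot-E₁ = degQuot-E }
  where
  module P₁ = Pullback₁ {n'} {s} {suc t'}
  module P₂ = Pullback₂ {n'} {s} {suc t'}

  E : Divisor (suc n') s (suc t')
  E (z j i) = 0ℤ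
  E (x j i) = ifZero j
  E (y j i) = ifZero j

  E-inv₁ : InvariantUnder σ₁ E
  E-inv₁ (z j i) = refl
  E-inv₁ (x j i) = refl
  E-inv₁ (y j i) = refl

  E-inv₂ : InvariantUnder σ₂ E
  E-inv₂ (z j i) = refl
  E-inv₂ (x j i) = refl
  E-inv₂ (y j i) = refl

  same-pullback : ∀ v → pullback σ₁ E v ≡ pullback σ₂ E v
  same-pullback (z j i) = trans (ℤP.*-zeroʳ (stab {t = suc t'} σ₁ (z j i))) (sym (ℤP.*-zeroʳ (stab {t = suc t'} σ₂ (z j i))))
  same-pullback (x j i) = trans (cong (_* ifZero j) (P₁.stab-x j i)) (sym (cong (_* ifZero j) (P₂.stab-x j i)))
  same-pullback (y j i) = trans (cong (_* ifZero j) (P₁.stab-y j i)) (sym (cong (_* ifZero j) (P₂.stab-y j i)))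

  degQuot-E : degQuot σ₁ E ≡ + suc n'
  degQuot-E = trans E.degQuot-orbits (trans (cong₂ _+_ repSumZ≡0 (∑∑-ifZero {t'} (suc n'))) (ℤP.+-identityˡ (+ suc n')))
    where
    module E = P₁.Invariant E E-inv₁
    repSumZ≡0 : E.repSumZ ≡ 0ℤ
    repSumZ≡0 = trans (∑∑-cong {s} {suc n'} {g = λ _ _ → 0ℤ} (λ j i → when-0 (P₁.IsRep i))) (∑∑-zero s (suc n'))
      where
      when-0 : ∀ b → when b 0ℤ ≡ 0ℤ
      when-0 true  = refl
      when-0 false = refl

-- Weight 1 at fixed points and 2 elsewhere, so that both pullbacks equal 2 on the first orbit.
zCommonPullback : ∀ {n' s'} → CommonPullback {n'} {suc s'} {0}
zCommonPullback {n'} {s'} = record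
  { E₁ = E₁ ; E₂ = E₂ ; E₁-inv = E₁-inv ; E₂-inv = E₂-inv ; same-pullback = same-pullback ; degQuot-E₁ = degQuot-E₁ }
  where
  module P₁ = Pullback₁ {n'} {suc s'} {0}
  module P₂ = Pullback₂ {n'} {suc s'} {0}
  N = suc n'

  E₁ E₂ : Divisor N (suc s') 0
  E₁ (z j i) = P₁.halvedAtFixed (λ _ → ifZero j) (λ _ → + 2 * ifZero j) i
  E₁ (x () _)
  E₁ (y () _)
  E₂ (z j i) = P₂.halvedAtFixed (λ _ → ifZero j) (λ _ → + 2 * ifZero j) i
  E₂ (x () _)
  E₂ (y () _)

  E₁-inv : InvariantUnder σ₁ E₁
  E₁-inv (z j i) = P₁.halvedAtFixed-∘r (λ _ → ifZero j) (λ _ → + 2 * ifZero j) (λ _ → refl) i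
  E₁-inv (x () _)
  E₁-inv (y () _)

  E₂-inv : InvariantUnder σ₂ E₂
  E₂-inv (z j i) = P₂.halvedAtFixed-∘r (λ _ → ifZero j) (λ _ → + 2 * ifZero j) (λ _ → refl) i
  E₂-inv (x () _)
  E₂-inv (y () _)

  pullback-E₁ : ∀ j i → pullback σ₁ E₁ (z j i) ≡ + 2 * ifZero j
  pullback-E₁ j i = trans (cong (_* E₁ (z j i)) (P₁.stab-z j i))
                          (P₁.stabFactor-halvedAtFixed (λ _ → ifZero j) (λ _ → + 2 * ifZero j) i (λ _ → refl))

  pullback-E₂ : ∀ j i → pullback σ₂ E₂ (z j i) ≡ + 2 * ifZero j
  pullback-E₂ j i = trans (cong (_* E₂ (z j i)) (P₂.stab-z j i))
                          (P₂.stabFactor-halvedAtFixed (λ _ → ifZero j) (λ _ → + 2 * ifZero j) i (λ _ → refl))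

  same-pullback : ∀ v → pullback σ₁ E₁ v ≡ pullback σ₂ E₂ v
  same-pullback (z j i) = trans (pullback-E₁ j i) (sym (pullback-E₂ j i))
  same-pullback (x () _)
  same-pullback (y () _)

  degQuot-E₁ : degQuot σ₁ E₁ ≡ + N
  degQuot-E₁ = ℤP.*-cancelˡ-≡ (+ 2) (degQuot σ₁ E₁) (+ N) (begin
    + 2 * degQuot σ₁ E₁                               ≡⟨ sym (P₁.Invariant.deg-pullback E₁ E₁-inv) ⟩
    deg (pullback σ₁ E₁)                              ≡⟨ sumℤ-allV (pullback σ₁ E₁) ⟩
    ∑∑ (λ j i → pullback σ₁ E₁ (z j i)) + (0ℤ + 0ℤ)   ≡⟨ ℤP.+-identityʳ _ ⟩
    ∑∑ (λ j i → pullback σ₁ E₁ (z j i))               ≡⟨ ∑∑-cong pullback-E₁ ⟩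
    ∑∑ {suc s'} {N} (λ j _ → + 2 * ifZero j)          ≡⟨ ∑∑-* {suc s'} {N} (+ 2) (λ j _ → ifZero j) ⟩
    + 2 * ∑∑ {suc s'} {N} (λ j _ → ifZero j)          ≡⟨ cong (+ 2 *_) (∑∑-ifZero {s'} N) ⟩
    + 2 * + N                                         ∎)
    where open ≡-Reasoning

balance : ∀ {n' s t} {δ : Divisor (suc n') s t} → Splitting δ → deg δ ≡ 0ℤ →
          + suc n' Signed.∣ weightedSum δ → Σ (Splitting δ) IsBalanced
balance {t = suc _}            = balanceWith xCommonPullback
balance {s = suc _} {t = zero} = balanceWith zCommonPullback
balance {s = zero}  {t = zero} sp _ _ = sp , refl , refl

Decomposition : ∀ {n s t} .{{_ : NonZero n}} → Divisor n s t → Set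
Decomposition {n} {s} {t} δ =
  Σ (Divisor n s t) λ δ₁ → Σ (Divisor n s t) λ δ₂ → P₁ δ₁ × P₂ δ₂ × (∀ v → δ v ≡ δ₁ v + δ₂ v)

Conditions : ∀ {n s t} → Divisor n s t → Set
Conditions {n} {s} {t} δ =
  (+ n ∣ weightedSum δ)
  × (∀ (j : Fin t) → sumFin n (λ i → δ (x j i)) ≡ sumFin n (λ i → δ (y j i)))
  × (∀ (j : Fin s) → + 2 ∣ sumFin n (λ i → δ (z j i)))

module _ {n' s t : ℕ} {δ : Divisor (suc n') s t} where

  decomposition⇒balanced : Decomposition δ → Σ (Splitting δ) IsBalanced
  decomposition⇒balanced (_ , _ , (D₁ , D₁-inv , q₁≡0 , δ₁≡) , (D₂ , D₂-inv , q₂≡0 , δ₂≡) , δ≡) =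
    record { D₁ = D₁ ; D₂ = D₂ ; D₁-inv = D₁-inv ; D₂-inv = D₂-inv
           ; splits = λ v → trans (δ≡ v) (cong₂ _+_ (δ₁≡ v) (δ₂≡ v)) } ,
    q₁≡0 , q₂≡0

  balanced⇒decomposition : Σ (Splitting δ) IsBalanced → Decomposition δ
  balanced⇒decomposition (sp , q₁≡0 , q₂≡0) =
    pullback σ₁ D₁ , pullback σ₂ D₂ , (D₁ , D₁-inv , q₁≡0 , λ _ → refl) , (D₂ , D₂-inv , q₂≡0 , λ _ → refl) , splits
    where open Splitting sp

  balanced⇒conditions : Σ (Splitting δ) IsBalanced → Conditions δ
  balanced⇒conditions (sp , q₁≡0 , q₂≡0) =
      Signed.∣⇒∣ᵤ (weightedSum-divisible (weightedSum-splitting sp))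
    , (λ j → trans (sumFin≡sum (suc n') (λ i → δ (x j i))) (trans (∑x≡∑y sp j) (sym (sumFin≡sum (suc n') (λ i → δ (y j i))))))
    , (λ j → Signed.∣⇒∣ᵤ (subst (+ 2 Signed.∣_) (sym (sumFin≡sum (suc n') (λ i → δ (z j i)))) (∑z-even sp j)))
    where
    open Splitting sp
    weightedSum-divisible : (Σ ℤ λ K → weightedSum δ ≡ degQuot σ₁ D₁ + + 2 * degQuot σ₂ D₂ + + suc n' * K) →
                            + suc n' Signed.∣ weightedSum δ
    weightedSum-divisible (K , ws≡) = Signed.divides K
      (trans ws≡ (trans (cong₂ (λ a b → a + + 2 * b + + suc n' * K) q₁≡0 q₂≡0) (simplify K (+ suc n'))))
      where
      simplify : ∀ K m → 0ℤ + + 2 * 0ℤ + m * K ≡ K * m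
      simplify = solve-∀

  conditions⇒balanced : deg δ ≡ 0ℤ → Conditions δ → Σ (Splitting δ) IsBalanced
  conditions⇒balanced deg≡0 (N∣ws , ∑x≡∑y , 2∣∑z) = balance splitting deg≡0 (Signed.∣ᵤ⇒∣ N∣ws)
    where
    splitting : Splitting δ
    splitting = splittingOf δ
      (λ j → trans (sym (sumFin≡sum (suc n') (λ i → δ (x j i)))) (trans (∑x≡∑y j) (sumFin≡sum (suc n') (λ i → δ (y j i)))))
      (λ j → subst (+ 2 Signed.∣_) (sumFin≡sum (suc n') (λ i → δ (z j i))) (Signed.∣ᵤ⇒∣ (2∣∑z j)))

-- The hypothesis 2 ≤ n is used only to write n = suc n'.
theorem3p2 : (n s t : ℕ) .{{_ : NonZero n}} → 2 ≤ n →
    (G : HarmonicDnGraph n s t) → Connected G →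
    (δ : Divisor n s t) → deg δ ≡ 0ℤ →
    (Σ (Divisor n s t) λ δ₁ → Σ (Divisor n s t) λ δ₂ →
        P₁ δ₁ × P₂ δ₂ × (∀ v → δ v ≡ δ₁ v + δ₂ v))
    ⇔
    ((+ n ∣ weightedSum δ)
     × (∀ (j : Fin t) → sumFin n (λ i → δ (x j i)) ≡ sumFin n (λ i → δ (y j i)))
     × (∀ (j : Fin s) → + 2 ∣ sumFin n (λ i → δ (z j i))))
theorem3p2 .(suc n') s t (ℕ.s≤s {n = n'} _) _ _ δ deg≡0 =
  mk⇔ (balanced⇒conditions ∘ decomposition⇒balanced)
      (balanced⇒decomposition ∘ conditions⇒balanced deg≡0)
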